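{- Let $q$ be a power of a prime $p\ge5$. Let $(s,t),(s',t')\in\mathbb F_q^2$ with $t(1+s+t)\neq0$, $t'(1+s'+t')\neq0$, such that $f_{s,t}$ and $f_{s',t'}$ are equivalent and \[ G_{s,t}=(X^2+a_1X+a_0)(X^2+b_1X+b_0),\qquad G_{s',t'}=(X^2+a_1'X+a_0')(X^2+b_1'X+b_0'), \] where in each factorization the two quadratic factors are distinct and irreducible over $\mathbb F_q$. Then $M(a_0,a_1)=M(a_0',a_1')$, where \[ M(X,Y)=\frac{(Y^2-4X)(2+2X+Y)}{Y(2+Y)(2X+Y)}. \]
   Context: $\mathbb F_q$ is the field with $q$ elements. For $s,t\in\mathbb F_q$ with $t(1+s+t)\ne0$, $f_{s,t}=\frac{X^3+sX+t}{X(X-1)}$ and $G_{s,t}(X)=X^4-2X^3-sX^2-2tX+t$. $\mathrm{PGL}(2,\mathbb F_q)$ is the group of rational functions $(aX+b)/(cX+d)$ with $ad-bc\ne0$ under composition; $f,g$ are equivalent if $g=\psi\circ f\circ\phi$ for some $\psi,\phi\in\mathrm{PGL}(2,\mathbb F_q)$. -}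

module Defs where

open import Data.Nat using (ℕ; zero; suc) renaming (_⊔_ to _⊔ℕ_)
open import Data.Fin using (Fin)
open import Data.List using (List; []; _∷_; length)
open import Data.Product using (Σ; _×_; _,_; ∃)
open import Data.Sum using (_⊎_)
open import Relation.Nullary using (¬_)
open import Relation.Binary.PropositionalEquality using (_≡_; _≢_)
open import Algebra.Structures using (IsCommutativeRing)
open import Function.Bundles using (_↔_)

-- A finite field with q elements (equality is propositional equality).
-- The inverse is total, with the standard convention 0⁻¹ = 0.
record FiniteField (q : ℕ) : Set₁ where
  infixl 6 _+_
  infixl 7 _*_
  field
    Carrier : Set
    _+_ _*_ : Carrier → Carrier → Carrier
    -_ : Carrier → Carrier
    0# 1# : Carrier
    isCommutativeRing : IsCommutativeRing _≡_ _+_ _*_ -_ 0# 1#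
    _⁻¹ : Carrier → Carrier
    0≢1 : 0# ≢ 1#
    ⁻¹-inverse : ∀ x → x ≢ 0# → x * (x ⁻¹) ≡ 1#
    0⁻¹≡0 : 0# ⁻¹ ≡ 0#
    card : Carrier ↔ Fin q

module Over {q : ℕ} (F : FiniteField q) where
  open FiniteField F public

  _-_ : Carrier → Carrier → Carrier
  x - y = x + (- y)

  _/_ : Carrier → Carrier → Carrier
  x / y = x * (y ⁻¹)

  2# : Carrier
  2# = 1# + 1#

  -- Polynomials in F[X]: coefficient lists, lowest degree first.
  Poly : Set
  Poly = List Carrier

  coeff : Poly → ℕ → Carrier
  coeff [] _ = 0#
  coeff (a ∷ _) zero = a
  coeff (_ ∷ p) (suc n) = coeff p n

  infix 4 _≈ₚ_
  _≈ₚ_ : Poly → Poly → Set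
  P ≈ₚ Q = ∀ n → coeff P n ≡ coeff Q n

  infixl 6 _+ₚ_
  _+ₚ_ : Poly → Poly → Poly
  [] +ₚ Q = Q
  (a ∷ P) +ₚ [] = a ∷ P
  (a ∷ P) +ₚ (b ∷ Q) = (a + b) ∷ (P +ₚ Q)

  scale : Carrier → Poly → Poly
  scale c [] = []
  scale c (a ∷ P) = (c * a) ∷ scale c P

  infixl 7 _*ₚ_
  _*ₚ_ : Poly → Poly → Poly
  [] *ₚ Q = []
  (a ∷ P) *ₚ Q = scale a Q +ₚ (0# ∷ (P *ₚ Q))

  constP : Carrier → Poly
  constP c = c ∷ []

  powP : Poly → ℕ → Poly
  powP P zero = constP 1#
  powP P (suc n) = P *ₚ powP P n

  IsUnit : Poly → Set
  IsUnit P = ∃ λ Q → P *ₚ Q ≈ₚ constP 1#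

  Irreducible : Poly → Set
  Irreducible P = (¬ (P ≈ₚ [])) × (¬ IsUnit P)
                  × (∀ G H → P ≈ₚ G *ₚ H → IsUnit G ⊎ IsUnit H)

  quad : Carrier → Carrier → Poly
  quad a₀ a₁ = a₀ ∷ a₁ ∷ 1# ∷ []

  G : Carrier → Carrier → Poly
  G s t = t ∷ (- (2# * t)) ∷ (- s) ∷ (- 2#) ∷ 1# ∷ []

  RatFun : Set
  RatFun = Poly × Poly

  infix 4 _≈ᵣ_
  _≈ᵣ_ : RatFun → RatFun → Set
  (N₁ , D₁) ≈ᵣ (N₂ , D₂) = N₁ *ₚ D₂ ≈ₚ N₂ *ₚ D₁

  f : Carrier → Carrier → RatFun
  f s t = (t ∷ s ∷ 0# ∷ 1# ∷ []) , (0# ∷ (- 1#) ∷ 1# ∷ [])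

  -- elements (aX+b)/(cX+d) of PGL(2,F_q)
  record Mobius : Set where
    constructor mob
    field
      a b c d : Carrier
      det≢0 : (a * d) - (b * c) ≢ 0#

  -- homogenisation: Σᵢ pᵢ uⁱ v^(m−i) for P = Σᵢ pᵢ Xⁱ (m ≥ deg P)
  homog : ℕ → Poly → Poly → Poly → Poly
  homog m [] u v = []
  homog zero (p ∷ P) u v = constP p
  homog (suc m) (p ∷ P) u v = (scale p (powP v (suc m))) +ₚ (u *ₚ homog m P u v)

  -- R ∘ φ, where φ = (aX+b)/(cX+d): substitute and clear the common
  -- power of (cX+d)
  precomp : RatFun → Mobius → RatFun
  precomp (N , D) (mob a b c d _) =
    let m = length N ⊔ℕ length D
        u = b ∷ a ∷ []
        v = d ∷ c ∷ []
    in homog m N u v , homog m D u v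

  postcomp : Mobius → RatFun → RatFun
  postcomp (mob α β γ δ _) (N , D) =
    (scale α N +ₚ scale β D) , (scale γ N +ₚ scale δ D)

  Equivalent : RatFun → RatFun → Set
  Equivalent h g = Σ Mobius λ ψ → Σ Mobius λ φ → g ≈ᵣ postcomp ψ (precomp h φ)

  M : Carrier → Carrier → Carrier
  M x y = (((y * y) - ((2# * 2#) * x)) * ((2# + (2# * x)) + y))
          / ((y * (2# + y)) * ((2# * x) + y))

{-# OPTIONS --safe #-}
module Submission where

-- For f = N / D the Wronskian N′D − ND′ is G, and it transforms as a binary
-- quartic: if f s′ t′ = ψ ∘ f s t ∘ φ then, after cancelling a common factor l
-- of numerator and denominator, l² G s′ t′ = det ψ det φ (G s t ∘ φ).  By
-- unique factorisation quad a₀′ a₁′ is then the monic pullback along φ of a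
-- quadratic factor of G s t.  M is a Möbius function of the ratio U : R of two
-- joint invariants of a binary quadratic and a binary cubic, taken at the
-- factor and at the denominator X² − X.  Pulling back along φ preserves the
-- ratio and takes X² − X to a member γ N + δ D of the pencil of f s t; and as
-- the roots of a factor of G are critical points of f, the ratio at a factor
-- is the same for every member of the pencil, and the same for both factors.

open import Defs
open import Data.Nat using (ℕ; _≤_; _^_)
open import Data.Nat.Primality using (Prime)
open import Data.Product using (_×_)
open import Relation.Nullary using (¬_)
open import Relation.Binary.PropositionalEquality using (_≡_; _≢_)

open import Algebra.Bundles using (CommutativeRing)
open import Algebra.Solver.Ring.AlmostCommutativeRing using (fromCommutativeRing; _-Raw-AlmostCommutative⟶_)
open import Data.Empty using (⊥-elim)
open import Data.Fin as Fin using (Fin)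
open import Data.Fin.Permutation using (permutation)
open import Data.Integer as ℤ using (ℤ; -[1+_]; ∣_∣; sign)
import Data.Integer.Properties as ℤ
open import Data.List using (List; []; _∷_; length)
import Data.Maybe as Maybe
open import Data.Nat as ℕ using (zero; suc)
import Data.Nat.Properties as ℕ
open import Data.Nat.DivMod using (m≡m%n+[m/n]*n; m%n<n)
open import Data.Nat.Divisibility using (_∣_; ∣1⇒≡1; m%n≡0⇒n∣m)
open import Data.Nat.Primality using (prime[2]; euclidsLemma; prime⇒irreducible)
open import Data.Product using (_,_; proj₁; proj₂; uncurry)
open import Data.Sign as Sign using (Sign)
open import Data.Sum using (_⊎_; inj₁; inj₂; [_,_])
open import Function using (_∘_)
open import Function.Bundles using (Inverse)
open import Relation.Binary.Bundles using (Setoid)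
open import Relation.Binary.Consequences using (dec⇒weaklyDec)
open import Relation.Binary.PropositionalEquality
  using (refl; sym; trans; cong; cong₂; subst; subst₂; module ≡-Reasoning)
open import Relation.Nullary using (Dec; yes; no)
open import Relation.Nullary.Decidable using (map′)

-- Every polynomial expression of the proof is written once over this
-- signature, and Forms repeats the polynomial arithmetic of Defs over it: read
-- in the field it computes the same terms as Defs, read in the syntax of the
-- ring solver it lets the solver prove identities about them.
record RingSyntax (A : Set) : Set where
  infixl 6 _⊕_
  infixl 7 _⊗_
  field
    _⊕_ _⊗_ : A → A → A
    ⊝_ : A → A
    ⟨_⟩ : ℕ → A

module Forms {A : Set} (ops : RingSyntax A) where
  open RingSyntax ops public

  infixl 6 _⊖_
  _⊖_ : A → A → A
  x ⊖ y = x ⊕ (⊝ y)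

  coeff : List A → ℕ → A
  coeff [] _ = ⟨ 0 ⟩
  coeff (a ∷ _) zero = a
  coeff (_ ∷ p) (suc n) = coeff p n

  infixl 6 _+ₚ_ _-ₚ_
  _+ₚ_ : List A → List A → List A
  [] +ₚ Q = Q
  (a ∷ P) +ₚ [] = a ∷ P
  (a ∷ P) +ₚ (b ∷ Q) = (a ⊕ b) ∷ (P +ₚ Q)

  scale : A → List A → List A
  scale c [] = []
  scale c (a ∷ P) = (c ⊗ a) ∷ scale c P

  infixl 7 _*ₚ_
  _*ₚ_ : List A → List A → List A
  [] *ₚ Q = []
  (a ∷ P) *ₚ Q = scale a Q +ₚ (⟨ 0 ⟩ ∷ (P *ₚ Q))

  powP : List A → ℕ → List A
  powP P zero = ⟨ 1 ⟩ ∷ []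
  powP P (suc n) = P *ₚ powP P n

  homog : ℕ → List A → List A → List A → List A
  homog m [] u v = []
  homog zero (p ∷ P) u v = p ∷ []
  homog (suc m) (p ∷ P) u v = (scale p (powP v (suc m))) +ₚ (u *ₚ homog m P u v)

  quad : A → A → List A
  quad a₀ a₁ = a₀ ∷ a₁ ∷ ⟨ 1 ⟩ ∷ []

  quadProduct : A → A → A → A → List A
  quadProduct a₀ a₁ b₀ b₁ = (a₀ ⊗ b₀) ∷ (a₀ ⊗ b₁ ⊕ a₁ ⊗ b₀) ∷ (a₀ ⊕ b₀ ⊕ a₁ ⊗ b₁) ∷ (a₁ ⊕ b₁) ∷ ⟨ 1 ⟩ ∷ []

  G : A → A → List A
  G s t = t ∷ (⊝ (⟨ 2 ⟩ ⊗ t)) ∷ (⊝ s) ∷ (⊝ ⟨ 2 ⟩) ∷ ⟨ 1 ⟩ ∷ []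

  numerator : A → A → List A
  numerator s t = t ∷ s ∷ ⟨ 0 ⟩ ∷ ⟨ 1 ⟩ ∷ []

  denominator : List A
  denominator = ⟨ 0 ⟩ ∷ (⊝ ⟨ 1 ⟩) ∷ ⟨ 1 ⟩ ∷ []

  Mnum Mden : A → A → A
  Mnum x y = ((y ⊗ y) ⊖ ((⟨ 2 ⟩ ⊗ ⟨ 2 ⟩) ⊗ x)) ⊗ ((⟨ 2 ⟩ ⊕ (⟨ 2 ⟩ ⊗ x)) ⊕ y)
  Mden x y = (y ⊗ (⟨ 2 ⟩ ⊕ y)) ⊗ ((⟨ 2 ⟩ ⊗ x) ⊕ y)

  _-ₚ_ : List A → List A → List A
  P -ₚ Q = P +ₚ scale (⊝ ⟨ 1 ⟩) Q

  value : List A → A → A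
  value [] x = ⟨ 0 ⟩
  value (a ∷ P) x = a ⊕ x ⊗ value P x

  cubic : A → A → A → A → List A
  cubic c₀ c₁ c₂ c₃ = c₀ ∷ c₁ ∷ c₂ ∷ c₃ ∷ []

  denominator₃ : List A
  denominator₃ = cubic ⟨ 0 ⟩ (⊝ ⟨ 1 ⟩) ⟨ 1 ⟩ ⟨ 0 ⟩

  pencil : A → A → List A → List A → List A
  pencil α β P Q = scale α P +ₚ scale β Q

  record Matrix : Set where
    constructor matrix
    field a b c d : A

  det : Matrix → A
  det (matrix a b c d) = a ⊗ d ⊖ b ⊗ c

  adjugate : Matrix → Matrix
  adjugate (matrix a b c d) = matrix d (⊝ b) (⊝ c) a

  -- P(aX + b, cX + d) for a form P of degree n
  compose : ℕ → List A → Matrix → List A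
  compose n P (matrix a b c d) = homog n P (b ∷ a ∷ []) (d ∷ c ∷ [])

  lowerRow : Matrix → List A
  lowerRow (matrix a b c d) = d ∷ c ∷ []

  derivative : List A → List A
  derivative [] = []
  derivative (_ ∷ P) = weighted 1 P
    where
    weighted : ℕ → List A → List A
    weighted n [] = []
    weighted n (p ∷ P) = (⟨ n ⟩ ⊗ p) ∷ weighted (suc n) P

  wronskian : List A → List A → List A
  wronskian P Q = derivative P *ₚ Q -ₚ P *ₚ derivative Q

  crossRemainder : A → A → List A → List A → List A
  crossRemainder s′ t′ P Q = numerator s′ t′ *ₚ Q -ₚ P *ₚ denominator₃

  slope : A → A → A
  slope a₀ a₁ = (⟨ 2 ⟩ ⊗ a₀) ⊕ a₁

  -- slope a₀ a₁ times γ (X³ + sX + t) + δ (X² − X) and times quad b₀ b₁, written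
  -- with w = b₀ · slope a₀ a₁ when G s t = quad a₀ a₁ · quad b₀ b₁; the
  -- factorisation gives w = a₀ (2 + a₁), which makes both polynomial in a₀, a₁.
  scaledPencil : A → A → A → A → A → List A
  scaledPencil a₀ a₁ w γ δ =
    cubic (γ ⊗ (a₀ ⊗ w)) (γ ⊗ (a₁ ⊗ (⟨ 2 ⟩ ⊕ a₁) ⊗ L ⊖ (a₀ ⊗ L ⊕ w)) ⊖ δ ⊗ L) (δ ⊗ L) (γ ⊗ L)
    where
    L : A
    L = slope a₀ a₁

  scaledPartner : A → A → A → List A
  scaledPartner a₀ a₁ w = w ∷ (⊝ (slope a₀ a₁ ⊗ (⟨ 2 ⟩ ⊕ a₁))) ∷ slope a₀ a₁ ∷ []

  -- Joint invariants of a binary quadratic Q and a binary cubic C, both of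
  -- degree 3 in Q and 2 in C, so that U : R is invariant under PGL(2).
  -- R is the resultant; U is, up to sign, the discriminant of Q times the
  -- apolar pairing of Q with the Hessian of C.
  module _ (Q C : List A) where
    private
      q₀ q₁ q₂ c₀ c₁ c₂ c₃ : A
      q₀ = coeff Q 0
      q₁ = coeff Q 1
      q₂ = coeff Q 2
      c₀ = coeff C 0
      c₁ = coeff C 1
      c₂ = coeff C 2
      c₃ = coeff C 3

    U R : A
    U = (q₁ ⊗ q₁ ⊖ ⟨ 4 ⟩ ⊗ q₂ ⊗ q₀) ⊗
        (⟨ 2 ⟩ ⊗ q₀ ⊗ (⟨ 3 ⟩ ⊗ c₃ ⊗ c₁ ⊖ c₂ ⊗ c₂) ⊕ ⟨ 2 ⟩ ⊗ q₂ ⊗ (⟨ 3 ⟩ ⊗ c₂ ⊗ c₀ ⊖ c₁ ⊗ c₁)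
         ⊖ q₁ ⊗ (⟨ 9 ⟩ ⊗ c₃ ⊗ c₀ ⊖ c₂ ⊗ c₁))
    R = q₂ ⊗ q₂ ⊗ q₂ ⊗ c₀ ⊗ c₀ ⊖ q₁ ⊗ q₂ ⊗ q₂ ⊗ c₀ ⊗ c₁ ⊕ q₀ ⊗ q₂ ⊗ q₂ ⊗ c₁ ⊗ c₁ ⊖ ⟨ 2 ⟩ ⊗ q₀ ⊗ q₂ ⊗ q₂ ⊗ c₀ ⊗ c₂
        ⊕ q₁ ⊗ q₁ ⊗ q₂ ⊗ c₀ ⊗ c₂ ⊖ q₀ ⊗ q₁ ⊗ q₂ ⊗ c₁ ⊗ c₂ ⊕ ⟨ 3 ⟩ ⊗ q₀ ⊗ q₁ ⊗ q₂ ⊗ c₀ ⊗ c₃ ⊕ q₀ ⊗ q₀ ⊗ q₂ ⊗ c₂ ⊗ c₂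
        ⊖ ⟨ 2 ⟩ ⊗ q₀ ⊗ q₀ ⊗ q₂ ⊗ c₁ ⊗ c₃ ⊖ q₁ ⊗ q₁ ⊗ q₁ ⊗ c₀ ⊗ c₃ ⊕ q₀ ⊗ q₁ ⊗ q₁ ⊗ c₁ ⊗ c₃ ⊖ q₀ ⊗ q₀ ⊗ q₁ ⊗ c₂ ⊗ c₃
        ⊕ q₀ ⊗ q₀ ⊗ q₀ ⊗ c₃ ⊗ c₃

module Arithmetic {q : ℕ} (F : FiniteField q) where
  open Over F public
  open ≡-Reasoning

  commutativeRing : CommutativeRing _ _
  commutativeRing = record { isCommutativeRing = isCommutativeRing }

  open CommutativeRing commutativeRing public
    using ( +-assoc; +-comm; +-identityˡ; +-identityʳ; -‿inverseˡ; -‿inverseʳ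
          ; *-assoc; *-comm; *-identityˡ; *-identityʳ; zeroˡ; zeroʳ
          ; ring; semiring; +-abelianGroup; +-commutativeMonoid )
  open import Algebra.Properties.Ring ring using (-‿distribˡ-*; -‿distribʳ-*)
  open import Algebra.Properties.AbelianGroup +-abelianGroup
    using (⁻¹-∙-comm; ⁻¹-involutive; ε⁻¹≈ε; xyx⁻¹≈y)
  open import Algebra.Properties.Semiring.Mult.TCOptimised semiring public
    using (×-homo-+; ×1-homo-*; 1+×; ×ᵤ≈×) renaming (_×_ to _×ₘ_)

  -- _×ₘ_ is the multiplication optimised for type checking, for which
  -- 2 ×ₘ 1# is exactly the 2# = 1# + 1# of Defs.
  ⟦_⟧ℤ : ℤ → Carrier
  ⟦ ℤ.+ n ⟧ℤ = n ×ₘ 1#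
  ⟦ -[1+ n ] ⟧ℤ = - (suc n ×ₘ 1#)

  private
    signed : Sign → Carrier → Carrier
    signed Sign.+ x = x
    signed Sign.- x = - x

    ◃-homo : ∀ s n → ⟦ s ℤ.◃ n ⟧ℤ ≡ signed s (n ×ₘ 1#)
    ◃-homo Sign.+ zero = refl
    ◃-homo Sign.- zero = sym ε⁻¹≈ε
    ◃-homo Sign.+ (suc n) = refl
    ◃-homo Sign.- (suc n) = refl

    signed-* : ∀ s t x y → signed (s Sign.* t) (x * y) ≡ signed s x * signed t y
    signed-* Sign.+ Sign.+ x y = refl
    signed-* Sign.+ Sign.- x y = -‿distribʳ-* x y
    signed-* Sign.- Sign.+ x y = -‿distribˡ-* x y
    signed-* Sign.- Sign.- x y = begin
      x * y          ≡⟨ sym (⁻¹-involutive _) ⟩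
      - - (x * y)    ≡⟨ cong -_ (-‿distribˡ-* x y) ⟩
      - (- x * y)    ≡⟨ -‿distribʳ-* (- x) y ⟩
      - x * - y      ∎

    ⊖-homo : ∀ m n → ⟦ m ℤ.⊖ n ⟧ℤ ≡ (m ×ₘ 1#) - (n ×ₘ 1#)
    ⊖-homo m zero = sym (trans (cong (m ×ₘ 1# +_) ε⁻¹≈ε) (+-identityʳ _))
    ⊖-homo zero (suc n) = sym (+-identityˡ _)
    ⊖-homo (suc m) (suc n) = begin
      ⟦ suc m ℤ.⊖ suc n ⟧ℤ                 ≡⟨ cong ⟦_⟧ℤ (ℤ.[1+m]⊖[1+n]≡m⊖n m n) ⟩
      ⟦ m ℤ.⊖ n ⟧ℤ                         ≡⟨ ⊖-homo m n ⟩
      a - b                               ≡⟨ cong (_+ - b) (sym (xyx⁻¹≈y 1# a)) ⟩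
      (1# + a) + - 1# + - b               ≡⟨ +-assoc _ _ _ ⟩
      (1# + a) + (- 1# + - b)             ≡⟨ cong ((1# + a) +_) (⁻¹-∙-comm 1# b) ⟩
      (1# + a) - (1# + b)                 ≡⟨ sym (cong₂ _-_ (1+× m 1#) (1+× n 1#)) ⟩
      (suc m ×ₘ 1#) - (suc n ×ₘ 1#)          ∎
      where
      a b : Carrier
      a = m ×ₘ 1#
      b = n ×ₘ 1#

  +-homo : ∀ i j → ⟦ i ℤ.+ j ⟧ℤ ≡ ⟦ i ⟧ℤ + ⟦ j ⟧ℤ
  +-homo (ℤ.+ m) (ℤ.+ n) = ×-homo-+ 1# m n
  +-homo (ℤ.+ m) -[1+ n ] = ⊖-homo m (suc n)
  +-homo -[1+ m ] (ℤ.+ n) = trans (⊖-homo n (suc m)) (+-comm _ _)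
  +-homo -[1+ m ] -[1+ n ] = begin
    - (suc (suc (m ℕ.+ n)) ×ₘ 1#)            ≡⟨ cong (λ k → - (suc k ×ₘ 1#)) (sym (ℕ.+-suc m n)) ⟩
    - ((suc m ℕ.+ suc n) ×ₘ 1#)              ≡⟨ cong -_ (×-homo-+ 1# (suc m) (suc n)) ⟩
    - (suc m ×ₘ 1# + suc n ×ₘ 1#)             ≡⟨ sym (⁻¹-∙-comm _ _) ⟩
    - (suc m ×ₘ 1#) + - (suc n ×ₘ 1#)         ∎

  *-homo : ∀ i j → ⟦ i ℤ.* j ⟧ℤ ≡ ⟦ i ⟧ℤ * ⟦ j ⟧ℤ
  *-homo i j = begin
    ⟦ (sign i Sign.* sign j) ℤ.◃ (∣ i ∣ ℕ.* ∣ j ∣) ⟧ℤ        ≡⟨ ◃-homo (sign i Sign.* sign j) (∣ i ∣ ℕ.* ∣ j ∣) ⟩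
    signed (sign i Sign.* sign j) ((∣ i ∣ ℕ.* ∣ j ∣) ×ₘ 1#)  ≡⟨ cong (signed (sign i Sign.* sign j)) (×1-homo-* ∣ i ∣ ∣ j ∣) ⟩
    signed (sign i Sign.* sign j) (∣ i ∣ ×ₘ 1# * ∣ j ∣ ×ₘ 1#) ≡⟨ signed-* (sign i) (sign j) _ _ ⟩
    signed (sign i) (∣ i ∣ ×ₘ 1#) * signed (sign j) (∣ j ∣ ×ₘ 1#) ≡⟨ sym (cong₂ _*_ (signed-abs i) (signed-abs j)) ⟩
    ⟦ i ⟧ℤ * ⟦ j ⟧ℤ                                        ∎
    where
    signed-abs : ∀ k → ⟦ k ⟧ℤ ≡ signed (sign k) (∣ k ∣ ×ₘ 1#)
    signed-abs k = trans (cong ⟦_⟧ℤ (sym (ℤ.◃-inverse k))) (◃-homo (sign k) ∣ k ∣)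

  -‿homo : ∀ i → ⟦ ℤ.- i ⟧ℤ ≡ - ⟦ i ⟧ℤ
  -‿homo (ℤ.+ zero) = sym ε⁻¹≈ε
  -‿homo (ℤ.+ suc n) = refl
  -‿homo -[1+ n ] = sym (⁻¹-involutive _)

  ℤ-homomorphism : ℤ.+-*-rawRing -Raw-AlmostCommutative⟶ fromCommutativeRing commutativeRing
  ℤ-homomorphism = record
    { ⟦_⟧ = ⟦_⟧ℤ ; +-homo = +-homo ; *-homo = *-homo ; -‿homo = -‿homo
    ; 0-homo = refl ; 1-homo = refl }

  open import Algebra.Solver.Ring ℤ.+-*-rawRing (fromCommutativeRing commutativeRing) ℤ-homomorphism
    (λ i j → Maybe.map (cong ⟦_⟧ℤ) (dec⇒weaklyDec ℤ._≟_ i j)) public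
    using (Polynomial; con; _:+_; _:*_; :-_; _:-_; solve; _:=_)

  carrierSyntax : RingSyntax Carrier
  carrierSyntax = record { _⊕_ = _+_ ; _⊗_ = _*_ ; ⊝_ = -_ ; ⟨_⟩ = _×ₘ 1# }

  solverSyntax : ∀ n → RingSyntax (Polynomial n)
  solverSyntax n = record { _⊕_ = _:+_ ; _⊗_ = _:*_ ; ⊝_ = :-_ ; ⟨_⟩ = λ k → con (ℤ.+ k) }

  _≟_ : (x y : Carrier) → Dec (x ≡ y)
  x ≟ y = map′ to-injective (cong to) (to x Fin.≟ to y)
    where
    open Inverse card using (to; from; strictlyInverseʳ)
    to-injective : ∀ {x y} → to x ≡ to y → x ≡ y
    to-injective {x} {y} e =
      trans (sym (strictlyInverseʳ x)) (trans (cong from e) (strictlyInverseʳ y))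

  x-y≡0⇒x≡y : ∀ {x y} → x - y ≡ 0# → x ≡ y
  x-y≡0⇒x≡y {x} {y} e = begin
    x              ≡⟨ solve 2 (λ x y → x := (x :- y) :+ y) refl x y ⟩
    (x - y) + y    ≡⟨ cong (_+ y) e ⟩
    0# + y         ≡⟨ +-identityˡ y ⟩
    y              ∎

  x≡y⇒x-y≡0 : ∀ {x y} → x ≡ y → x - y ≡ 0#
  x≡y⇒x-y≡0 {x} refl = -‿inverseʳ x

  x*y≡0⇒y≡0 : ∀ {x y} → x ≢ 0# → x * y ≡ 0# → y ≡ 0#
  x*y≡0⇒y≡0 {x} {y} x≢0 xy≡0 = begin
    y                ≡⟨ sym (*-identityˡ y) ⟩
    1# * y           ≡⟨ cong (_* y) (sym (trans (*-comm (x ⁻¹) x) (⁻¹-inverse x x≢0))) ⟩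
    (x ⁻¹ * x) * y   ≡⟨ *-assoc _ _ _ ⟩
    x ⁻¹ * (x * y)   ≡⟨ cong (x ⁻¹ *_) xy≡0 ⟩
    x ⁻¹ * 0#        ≡⟨ zeroʳ _ ⟩
    0#               ∎

  x*y≢0 : ∀ {x y} → x ≢ 0# → y ≢ 0# → x * y ≢ 0#
  x*y≢0 x≢0 y≢0 xy≡0 = y≢0 (x*y≡0⇒y≡0 x≢0 xy≡0)

  x*y≢0⇒x≢0 : ∀ {x y} → x * y ≢ 0# → x ≢ 0#
  x*y≢0⇒x≢0 {y = y} xy≢0 x≡0 = xy≢0 (trans (cong (_* y) x≡0) (zeroˡ y))

  x*y≢0⇒y≢0 : ∀ {x y} → x * y ≢ 0# → y ≢ 0#
  x*y≢0⇒y≢0 {x} xy≢0 y≡0 = xy≢0 (trans (cong (x *_) y≡0) (zeroʳ x))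

  *-cancelˡ : ∀ {x y z} → x ≢ 0# → x * y ≡ x * z → y ≡ z
  *-cancelˡ {x} {y} {z} x≢0 e = x-y≡0⇒x≡y (x*y≡0⇒y≡0 x≢0 (begin
    x * (y - z)        ≡⟨ solve 3 (λ x y z → x :* (y :- z) := x :* y :- x :* z) refl x y z ⟩
    (x * y) - (x * z)  ≡⟨ x≡y⇒x-y≡0 e ⟩
    0#                 ∎))

  x*y′≡x′*y⇒x/y≡x′/y′ : ∀ {x y x′ y′} → y ≢ 0# → y′ ≢ 0# → x * y′ ≡ x′ * y → x / y ≡ x′ / y′
  x*y′≡x′*y⇒x/y≡x′/y′ {x} {y} {x′} {y′} y≢0 y′≢0 e = *-cancelˡ (x*y≢0 y≢0 y′≢0) (begin
    (y * y′) * (x * y ⁻¹)        ≡⟨ solve 4 (λ x y y′ i → (y :* y′) :* (x :* i) := (y :* i) :* (x :* y′)) refl x y y′ (y ⁻¹) ⟩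
    (y * y ⁻¹) * (x * y′)        ≡⟨ cong₂ (λ u v → u * v) (⁻¹-inverse y y≢0) e ⟩
    1# * (x′ * y)                ≡⟨ cong (_* (x′ * y)) (sym (⁻¹-inverse y′ y′≢0)) ⟩
    (y′ * y′ ⁻¹) * (x′ * y)      ≡⟨ solve 4 (λ x′ y y′ i → (y′ :* i) :* (x′ :* y) := (y :* y′) :* (x′ :* i)) refl x′ y y′ (y′ ⁻¹) ⟩
    (y * y′) * (x′ * y′ ⁻¹)      ∎)

  combination-zero : ∀ {a b c} x y z → a ≡ 0# → b ≡ 0# → c ≡ 0# → x * a + y * b + z * c ≡ 0#
  combination-zero x y z refl refl refl =
    solve 3 (λ x y z → x :* con (ℤ.+ 0) :+ y :* con (ℤ.+ 0) :+ z :* con (ℤ.+ 0) := con (ℤ.+ 0)) refl x y z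

  -- Translation by 1# permutes the field, so Σ x = Σ (x + 1) = Σ x + q · 1.
  q×1≡0 : q ×ₘ 1# ≡ 0#
  q×1≡0 = begin
    q ×ₘ 1#                      ≡⟨ solve 2 (λ S y → y := :- S :+ (S :+ y)) refl S (q ×ₘ 1#) ⟩
    - S + (S + q ×ₘ 1#)          ≡⟨ cong (- S +_) (sym S≡S+q×1) ⟩
    - S + S                      ≡⟨ -‿inverseˡ S ⟩
    0#                           ∎
    where
    open Inverse card using (to; from; strictlyInverseˡ; strictlyInverseʳ)
    open import Algebra.Properties.CommutativeMonoid.Sum +-commutativeMonoid
      using (sum; sum-permute; ∑-distrib-+; sum-cong-≗; sum-replicate)
    S : Carrier
    S = sum from
    shift : Fin q → Fin q
    shift i = to (from i + 1#)
    unshift : Fin q → Fin q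
    unshift i = to (from i - 1#)
    S≡S+q×1 : S ≡ S + q ×ₘ 1#
    S≡S+q×1 = begin
      sum from                                ≡⟨ sum-permute from (permutation shift unshift shift∘unshift unshift∘shift) ⟩
      sum (λ i → from (shift i))              ≡⟨ sum-cong-≗ (λ i → strictlyInverseʳ (from i + 1#)) ⟩
      sum (λ i → from i + 1#)                 ≡⟨ ∑-distrib-+ from (λ _ → 1#) ⟩
      S + sum {q} (λ _ → 1#)                  ≡⟨ cong (S +_) (trans (sum-replicate q) (×ᵤ≈× q 1#)) ⟩
      S + q ×ₘ 1#                             ∎
      where
      shift∘unshift : ∀ i → shift (unshift i) ≡ i
      shift∘unshift i = trans (cong (λ x → to (x + 1#)) (strictlyInverseʳ _))
        (trans (cong to (solve 2 (λ x y → (x :- y) :+ y := x) refl (from i) 1#)) (strictlyInverseˡ i))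
      unshift∘shift : ∀ i → unshift (shift i) ≡ i
      unshift∘shift i = trans (cong (λ x → to (x - 1#)) (strictlyInverseʳ _))
        (trans (cong to (solve 2 (λ x y → (x :+ y) :- y := x) refl (from i) 1#)) (strictlyInverseˡ i))

  characteristic≢2 : ∀ p k → Prime p → 5 ≤ p → q ≡ p ^ k → 2# ≢ 0#
  characteristic≢2 p k p-prime 5≤p q≡pᵏ 2≡0 = 0≢1 (begin
    0#                                     ≡⟨ sym q×1≡0 ⟩
    q ×ₘ 1#                                ≡⟨ cong (_×ₘ 1#) (m≡m%n+[m/n]*n q 2) ⟩
    (q ℕ.% 2 ℕ.+ (q ℕ./ 2) ℕ.* 2) ×ₘ 1#    ≡⟨ cong (λ r → (r ℕ.+ (q ℕ./ 2) ℕ.* 2) ×ₘ 1#) q%2≡1 ⟩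
    (1 ℕ.+ (q ℕ./ 2) ℕ.* 2) ×ₘ 1#          ≡⟨ ×-homo-+ 1# 1 ((q ℕ./ 2) ℕ.* 2) ⟩
    1# + ((q ℕ./ 2) ℕ.* 2) ×ₘ 1#           ≡⟨ cong (1# +_) (×1-homo-* (q ℕ./ 2) 2) ⟩
    1# + (q ℕ./ 2) ×ₘ 1# * 2#              ≡⟨ cong (λ z → 1# + (q ℕ./ 2) ×ₘ 1# * z) 2≡0 ⟩
    1# + (q ℕ./ 2) ×ₘ 1# * 0#              ≡⟨ trans (cong (1# +_) (zeroʳ _)) (+-identityʳ 1#) ⟩
    1#                                     ∎)
    where
    2∤p : ¬ 2 ∣ p
    2∤p 2∣p with prime⇒irreducible p-prime 2∣p
    ... | inj₂ 2≡p with subst (5 ≤_) (sym 2≡p) 5≤p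
    ...   | ℕ.s≤s (ℕ.s≤s ())
    2∤pⁿ : ∀ n → ¬ 2 ∣ p ^ n
    2∤pⁿ zero 2∣1 with ∣1⇒≡1 2∣1
    ... | ()
    2∤pⁿ (suc n) 2∣pⁿ⁺¹ with euclidsLemma p (p ^ n) prime[2] 2∣pⁿ⁺¹
    ... | inj₁ 2∣p = 2∤p 2∣p
    ... | inj₂ 2∣pⁿ = 2∤pⁿ n 2∣pⁿ
    q%2≡1 : q ℕ.% 2 ≡ 1
    q%2≡1 with q ℕ.% 2 in eq | m%n<n q 2
    ... | 0 | _ = ⊥-elim (subst (λ m → ¬ 2 ∣ m) (sym q≡pᵏ) (2∤pⁿ k) (m%n≡0⇒n∣m q 2 eq))
    ... | 1 | _ = refl
    ... | suc (suc _) | ℕ.s≤s (ℕ.s≤s ())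

module Polynomials {q : ℕ} (F : FiniteField q) where
  open Arithmetic F
  open Forms carrierSyntax public using (value; quadProduct)
  open ≡-Reasoning
  private module S {n : ℕ} = Forms (solverSyntax n)

  coeff-+ₚ : ∀ P Q n → coeff (P +ₚ Q) n ≡ coeff P n + coeff Q n
  coeff-+ₚ [] Q n = sym (+-identityˡ _)
  coeff-+ₚ (a ∷ P) [] n = sym (+-identityʳ _)
  coeff-+ₚ (a ∷ P) (b ∷ Q) zero = refl
  coeff-+ₚ (a ∷ P) (b ∷ Q) (suc n) = coeff-+ₚ P Q n

  coeff-scale : ∀ c P n → coeff (scale c P) n ≡ c * coeff P n
  coeff-scale c [] n = sym (zeroʳ c)
  coeff-scale c (a ∷ P) zero = refl
  coeff-scale c (a ∷ P) (suc n) = coeff-scale c P n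

  ≈ₚ-setoid : Setoid _ _
  ≈ₚ-setoid = record
    { Carrier = Poly
    ; _≈_ = _≈ₚ_
    ; isEquivalence = record
      { refl = λ _ → refl
      ; sym = λ P≈Q → sym ∘ P≈Q
      ; trans = λ P≈Q Q≈R n → trans (P≈Q n) (Q≈R n)
      }
    }

  ≈ₚ⇒≡ : ∀ {P Q} → length P ≡ length Q → P ≈ₚ Q → P ≡ Q
  ≈ₚ⇒≡ {[]} {[]} _ _ = refl
  ≈ₚ⇒≡ {a ∷ P} {b ∷ Q} |P|≡|Q| P≈Q = cong₂ _∷_ (P≈Q 0) (≈ₚ⇒≡ (ℕ.suc-injective |P|≡|Q|) (P≈Q ∘ suc))

  scale-cancel : ∀ {c} P Q → c ≢ 0# → scale c P ≈ₚ scale c Q → P ≈ₚ Q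
  scale-cancel {c} P Q c≢0 cP≈cQ n =
    *-cancelˡ c≢0 (trans (sym (coeff-scale c P n)) (trans (cP≈cQ n) (coeff-scale c Q n)))

  scale-cong : ∀ c P Q → P ≈ₚ Q → scale c P ≈ₚ scale c Q
  scale-cong c P Q P≈Q n = trans (coeff-scale c P n) (trans (cong (c *_) (P≈Q n)) (sym (coeff-scale c Q n)))

  scale-scale : ∀ c d P → scale c (scale d P) ≈ₚ scale (c * d) P
  scale-scale c d P n = begin
    coeff (scale c (scale d P)) n   ≡⟨ trans (coeff-scale c (scale d P) n) (cong (c *_) (coeff-scale d P n)) ⟩
    c * (d * coeff P n)             ≡⟨ sym (*-assoc c d _) ⟩
    (c * d) * coeff P n             ≡⟨ sym (coeff-scale (c * d) P n) ⟩
    coeff (scale (c * d) P) n       ∎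

  private
    coeff-linear-*ₚ-zero : ∀ c d r → coeff ((d ∷ c ∷ []) *ₚ r) 0 ≡ d * coeff r 0
    coeff-linear-*ₚ-zero c d r = begin
      coeff (scale d r +ₚ (0# ∷ (scale c r +ₚ (0# ∷ [])))) 0   ≡⟨ coeff-+ₚ (scale d r) _ 0 ⟩
      coeff (scale d r) 0 + 0#                              ≡⟨ +-identityʳ _ ⟩
      coeff (scale d r) 0                                   ≡⟨ coeff-scale d r 0 ⟩
      d * coeff r 0                                         ∎

    coeff-linear-*ₚ-suc : ∀ c d r n →
      coeff ((d ∷ c ∷ []) *ₚ r) (suc n) ≡ d * coeff r (suc n) + c * coeff r n
    coeff-linear-*ₚ-suc c d r n = begin
      coeff (scale d r +ₚ (0# ∷ (scale c r +ₚ (0# ∷ [])))) (suc n)   ≡⟨ coeff-+ₚ (scale d r) _ (suc n) ⟩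
      coeff (scale d r) (suc n) + coeff (scale c r +ₚ (0# ∷ [])) n  ≡⟨ cong₂ _+_ (coeff-scale d r (suc n)) (coeff-+ₚ (scale c r) _ n) ⟩
      d * coeff r (suc n) + (coeff (scale c r) n + coeff (0# ∷ []) n) ≡⟨ cong (λ z → d * coeff r (suc n) + (coeff (scale c r) n + z)) (coeff-zero n) ⟩
      d * coeff r (suc n) + (coeff (scale c r) n + 0#)             ≡⟨ cong (d * coeff r (suc n) +_) (trans (+-identityʳ _) (coeff-scale c r n)) ⟩
      d * coeff r (suc n) + c * coeff r n                          ∎
      where
      coeff-zero : ∀ n → coeff (0# ∷ []) n ≡ 0#
      coeff-zero zero = refl
      coeff-zero (suc n) = refl

  linear-factor-cancel : ∀ {c d} r → ¬ (c ≡ 0# × d ≡ 0#) → (d ∷ c ∷ []) *ₚ r ≈ₚ [] → r ≈ₚ []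
  linear-factor-cancel {c} {d} r cd≢0 dr≈0 with d ≟ 0#
  ... | no d≢0 = upwards
    where
    upwards : ∀ n → coeff r n ≡ 0#
    upwards zero = x*y≡0⇒y≡0 d≢0 (trans (sym (coeff-linear-*ₚ-zero c d r)) (dr≈0 0))
    upwards (suc n) = x*y≡0⇒y≡0 d≢0 (begin
      d * coeff r (suc n)                        ≡⟨ sym (+-identityʳ _) ⟩
      d * coeff r (suc n) + 0#                   ≡⟨ cong (d * coeff r (suc n) +_) (sym (trans (cong (c *_) (upwards n)) (zeroʳ c))) ⟩
      d * coeff r (suc n) + c * coeff r n        ≡⟨ sym (coeff-linear-*ₚ-suc c d r n) ⟩
      coeff ((d ∷ c ∷ []) *ₚ r) (suc n)          ≡⟨ dr≈0 (suc n) ⟩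
      0#                                         ∎)
  ... | yes d≡0 = λ n → x*y≡0⇒y≡0 (λ c≡0 → cd≢0 (c≡0 , d≡0)) (begin
      c * coeff r n                              ≡⟨ sym (+-identityˡ _) ⟩
      0# + c * coeff r n                         ≡⟨ cong (_+ c * coeff r n) (sym (trans (cong (_* coeff r (suc n)) d≡0) (zeroˡ _))) ⟩
      d * coeff r (suc n) + c * coeff r n        ≡⟨ sym (coeff-linear-*ₚ-suc c d r n) ⟩
      coeff ((d ∷ c ∷ []) *ₚ r) (suc n)          ≡⟨ dr≈0 (suc n) ⟩
      0#                                         ∎)

  value-+ₚ : ∀ P Q x → value (P +ₚ Q) x ≡ value P x + value Q x
  value-+ₚ [] Q x = sym (+-identityˡ _)
  value-+ₚ (a ∷ P) [] x = sym (+-identityʳ _)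
  value-+ₚ (a ∷ P) (b ∷ Q) x = trans (cong (λ v → (a + b) + x * v) (value-+ₚ P Q x))
    (solve 5 (λ a b x p q → (a :+ b) :+ x :* (p :+ q) := (a :+ x :* p) :+ (b :+ x :* q)) refl a b x (value P x) (value Q x))

  value-scale : ∀ c P x → value (scale c P) x ≡ c * value P x
  value-scale c [] x = sym (zeroʳ c)
  value-scale c (a ∷ P) x = trans (cong (λ v → c * a + x * v) (value-scale c P x))
    (solve 4 (λ c a x p → c :* a :+ x :* (c :* p) := c :* (a :+ x :* p)) refl c a x (value P x))

  value-*ₚ : ∀ P Q x → value (P *ₚ Q) x ≡ value P x * value Q x
  value-*ₚ [] Q x = sym (zeroˡ _)
  value-*ₚ (a ∷ P) Q x = begin
    value (scale a Q +ₚ (0# ∷ (P *ₚ Q))) x           ≡⟨ value-+ₚ (scale a Q) _ x ⟩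
    value (scale a Q) x + (0# + x * value (P *ₚ Q) x) ≡⟨ cong₂ (λ u v → u + (0# + x * v)) (value-scale a Q x) (value-*ₚ P Q x) ⟩
    a * value Q x + (0# + x * (value P x * value Q x)) ≡⟨ solve 4 (λ a x p q → a :* q :+ (con (ℤ.+ 0) :+ x :* (p :* q)) := (a :+ x :* p) :* q) refl a x (value P x) (value Q x) ⟩
    (a + x * value P x) * value Q x                 ∎

  value-≈ₚ[] : ∀ {P} x → P ≈ₚ [] → value P x ≡ 0#
  value-≈ₚ[] {[]} x P≈0 = refl
  value-≈ₚ[] {a ∷ P} x P≈0 = begin
    a + x * value P x    ≡⟨ cong₂ (λ u v → u + x * v) (P≈0 0) (value-≈ₚ[] {P} x (P≈0 ∘ suc)) ⟩
    0# + x * 0#          ≡⟨ trans (+-identityˡ _) (zeroʳ x) ⟩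
    0#                   ∎

  value-≈ₚ : ∀ {P Q} x → P ≈ₚ Q → value P x ≡ value Q x
  value-≈ₚ {[]} {Q} x P≈Q = sym (value-≈ₚ[] {Q} x (sym ∘ P≈Q))
  value-≈ₚ {a ∷ P} {[]} x P≈Q = value-≈ₚ[] {a ∷ P} x P≈Q
  value-≈ₚ {a ∷ P} {b ∷ Q} x P≈Q = cong₂ (λ u v → u + x * v) (P≈Q 0) (value-≈ₚ {P} {Q} x (P≈Q ∘ suc))

  monic-linear-not-unit : ∀ c → ¬ IsUnit (c ∷ 1# ∷ [])
  monic-linear-not-unit c (Q , cQ≈1) = 0≢1 (begin
    0#                                           ≡⟨ sym (zeroˡ _) ⟩
    0# * value Q (- c)                           ≡⟨ cong (_* value Q (- c)) (sym root) ⟩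
    value (c ∷ 1# ∷ []) (- c) * value Q (- c)    ≡⟨ sym (value-*ₚ (c ∷ 1# ∷ []) Q (- c)) ⟩
    value ((c ∷ 1# ∷ []) *ₚ Q) (- c)             ≡⟨ value-≈ₚ {(c ∷ 1# ∷ []) *ₚ Q} {1# ∷ []} (- c) cQ≈1 ⟩
    value (1# ∷ []) (- c)                        ≡⟨ solve 1 (λ c → S.value (S.⟨ 1 ⟩ ∷ []) (:- c) := S.⟨ 1 ⟩) refl c ⟩
    1#                                           ∎)
    where
    root : value (c ∷ 1# ∷ []) (- c) ≡ 0#
    root = solve 1 (λ c → S.value (c ∷ S.⟨ 1 ⟩ ∷ []) (:- c) := S.⟨ 0 ⟩) refl c

  private
    split-at-root : ∀ {a₀ a₁} x → value (quad a₀ a₁) x ≡ 0# →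
      quad a₀ a₁ ≈ₚ ((- x) ∷ 1# ∷ []) *ₚ ((a₁ + x) ∷ 1# ∷ [])
    split-at-root {a₀} {a₁} x root zero = sym (begin
      coeff (((- x) ∷ 1# ∷ []) *ₚ ((a₁ + x) ∷ 1# ∷ [])) 0
        ≡⟨ solve 3 (λ a₀ a₁ x → S.coeff ((S.⊝ x ∷ S.⟨ 1 ⟩ ∷ []) S.*ₚ ((a₁ :+ x) ∷ S.⟨ 1 ⟩ ∷ [])) 0
                                 := a₀ :- S.value (S.quad a₀ a₁) x) refl a₀ a₁ x ⟩
      a₀ - value (quad a₀ a₁) x                         ≡⟨ cong (λ v → a₀ - v) root ⟩
      a₀ - 0#                                          ≡⟨ solve 1 (λ a₀ → a₀ :- S.⟨ 0 ⟩ := a₀) refl a₀ ⟩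
      a₀                                               ∎)
    split-at-root {a₀} {a₁} x root 1 = solve 2 (λ a₁ x →
      a₁ := S.coeff ((S.⊝ x ∷ S.⟨ 1 ⟩ ∷ []) S.*ₚ ((a₁ :+ x) ∷ S.⟨ 1 ⟩ ∷ [])) 1) refl a₁ x
    split-at-root {a₀} {a₁} x root 2 = solve 2 (λ a₁ x →
      S.⟨ 1 ⟩ := S.coeff ((S.⊝ x ∷ S.⟨ 1 ⟩ ∷ []) S.*ₚ ((a₁ :+ x) ∷ S.⟨ 1 ⟩ ∷ [])) 2) refl a₁ x
    split-at-root x root (suc (suc (suc n))) = refl

  irreducible⇒no-root : ∀ {a₀ a₁} → Irreducible (quad a₀ a₁) → ∀ x → value (quad a₀ a₁) x ≢ 0#
  irreducible⇒no-root {a₀} {a₁} (_ , _ , irreducible) x root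
    with irreducible ((- x) ∷ 1# ∷ []) ((a₁ + x) ∷ 1# ∷ []) (split-at-root x root)
  ... | inj₁ unit = monic-linear-not-unit (- x) unit
  ... | inj₂ unit = monic-linear-not-unit (a₁ + x) unit

  quad-*ₚ-quad : ∀ a₀ a₁ b₀ b₁ → quad a₀ a₁ *ₚ quad b₀ b₁ ≡ quadProduct a₀ a₁ b₀ b₁
  quad-*ₚ-quad a₀ a₁ b₀ b₁ = ≈ₚ⇒≡ refl coefficients
    where
    coefficients : quad a₀ a₁ *ₚ quad b₀ b₁ ≈ₚ quadProduct a₀ a₁ b₀ b₁
    coefficients 0 = solve 4 (λ a₀ a₁ b₀ b₁ →
      S.coeff (S.quad a₀ a₁ S.*ₚ S.quad b₀ b₁) 0 := S.coeff (S.quadProduct a₀ a₁ b₀ b₁) 0) refl a₀ a₁ b₀ b₁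
    coefficients 1 = solve 4 (λ a₀ a₁ b₀ b₁ →
      S.coeff (S.quad a₀ a₁ S.*ₚ S.quad b₀ b₁) 1 := S.coeff (S.quadProduct a₀ a₁ b₀ b₁) 1) refl a₀ a₁ b₀ b₁
    coefficients 2 = solve 4 (λ a₀ a₁ b₀ b₁ →
      S.coeff (S.quad a₀ a₁ S.*ₚ S.quad b₀ b₁) 2 := S.coeff (S.quadProduct a₀ a₁ b₀ b₁) 2) refl a₀ a₁ b₀ b₁
    coefficients 3 = solve 4 (λ a₀ a₁ b₀ b₁ →
      S.coeff (S.quad a₀ a₁ S.*ₚ S.quad b₀ b₁) 3 := S.coeff (S.quadProduct a₀ a₁ b₀ b₁) 3) refl a₀ a₁ b₀ b₁
    coefficients 4 = solve 4 (λ a₀ a₁ b₀ b₁ →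
      S.coeff (S.quad a₀ a₁ S.*ₚ S.quad b₀ b₁) 4 := S.coeff (S.quadProduct a₀ a₁ b₀ b₁) 4) refl a₀ a₁ b₀ b₁
    coefficients (suc (suc (suc (suc (suc n))))) = refl

  linear-product-zero : ∀ {e g e′ g′} → e * e′ ≡ 0# → e * g′ + g * e′ ≡ 0# → g * g′ ≡ 0# →
    (e ≡ 0# × g ≡ 0#) ⊎ (e′ ≡ 0# × g′ ≡ 0#)
  linear-product-zero {e} {g} {e′} {g′} ee′≡0 middle≡0 gg′≡0 with e ≟ 0# | g ≟ 0#
  ... | yes e≡0 | yes g≡0 = inj₁ (e≡0 , g≡0)
  ... | no e≢0 | _ = inj₂ (e′≡0 , x*y≡0⇒y≡0 e≢0 (begin
      e * g′               ≡⟨ sym (+-identityʳ _) ⟩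
      e * g′ + 0#          ≡⟨ cong (e * g′ +_) (sym (trans (cong (g *_) e′≡0) (zeroʳ g))) ⟩
      e * g′ + g * e′      ≡⟨ middle≡0 ⟩
      0#                   ∎))
    where
    e′≡0 : e′ ≡ 0#
    e′≡0 = x*y≡0⇒y≡0 e≢0 ee′≡0
  ... | yes e≡0 | no g≢0 = inj₂ (x*y≡0⇒y≡0 g≢0 (begin
      g * e′               ≡⟨ sym (+-identityˡ _) ⟩
      0# + g * e′          ≡⟨ cong (_+ g * e′) (sym (trans (cong (_* g′) e≡0) (zeroˡ g′))) ⟩
      e * g′ + g * e′      ≡⟨ middle≡0 ⟩
      0#                   ∎) , x*y≡0⇒y≡0 g≢0 gg′≡0)

  -- If x₁ ≠ u₁, compare B and V at the root z of A − U, where A does not vanish.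
  equal-constant-sums : ∀ {x₀ x₁ y₀ y₁ u₀ u₁ v₀ v₁} → (∀ z → value (quad x₀ x₁) z ≢ 0#) →
    quad x₀ x₁ *ₚ quad y₀ y₁ ≈ₚ quad u₀ u₁ *ₚ quad v₀ v₁ → (x₀ + y₀) - (u₀ + v₀) ≡ 0#
  equal-constant-sums {x₀} {x₁} {y₀} {y₁} {u₀} {u₁} {v₀} {v₁} no-root XY≈UV = by-cases ((x₁ - u₁) ≟ 0#)
    where
    E : quadProduct x₀ x₁ y₀ y₁ ≈ₚ quadProduct u₀ u₁ v₀ v₁
    E = subst₂ _≈ₚ_ (quad-*ₚ-quad x₀ x₁ y₀ y₁) (quad-*ₚ-quad u₀ u₁ v₀ v₁) XY≈UV

    by-cases : Dec (x₁ - u₁ ≡ 0#) → (x₀ + y₀) - (u₀ + v₀) ≡ 0#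
    by-cases (yes e≡0) = trans
      (solve 8 (λ x₀ x₁ y₀ y₁ u₀ u₁ v₀ v₁ → (x₀ :+ y₀) :- (u₀ :+ v₀)
         := S.⟨ 1 ⟩ :* ((x₀ :+ y₀ :+ x₁ :* y₁) :- (u₀ :+ v₀ :+ u₁ :* v₁)) :+ (:- x₁) :* ((x₁ :+ y₁) :- (u₁ :+ v₁))
            :+ (x₁ :- v₁) :* (x₁ :- u₁)) refl x₀ x₁ y₀ y₁ u₀ u₁ v₀ v₁)
      (combination-zero 1# (- x₁) (x₁ - v₁) (x≡y⇒x-y≡0 (E 2)) (x≡y⇒x-y≡0 (E 3)) e≡0)
    by-cases (no e≢0) = trans
      (solve 9 (λ x₀ x₁ y₀ y₁ u₀ u₁ v₀ v₁ z → (x₀ :+ y₀) :- (u₀ :+ v₀)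
         := S.⟨ 1 ⟩ :* (S.value (S.quad y₀ y₁) z :- S.value (S.quad v₀ v₁) z)
            :+ S.⟨ 1 ⟩ :* ((x₁ :- u₁) :* z :+ (x₀ :- u₀)) :+ (:- z) :* ((x₁ :+ y₁) :- (u₁ :+ v₁)))
         refl x₀ x₁ y₀ y₁ u₀ u₁ v₀ v₁ z)
      (combination-zero 1# 1# (- z) ΔB linear-root (x≡y⇒x-y≡0 (E 3)))
      where
      e g z : Carrier
      e = x₁ - u₁
      g = x₀ - u₀
      z = - (g * e ⁻¹)
      linear-root : e * z + g ≡ 0#
      linear-root = begin
        e * z + g               ≡⟨ solve 3 (λ e g i → e :* (:- (g :* i)) :+ g := g :* (S.⟨ 1 ⟩ :- e :* i)) refl e g (e ⁻¹) ⟩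
        g * (1# - (e * e ⁻¹))   ≡⟨ cong (λ w → g * (1# - w)) (⁻¹-inverse e e≢0) ⟩
        g * (1# - 1#)           ≡⟨ solve 1 (λ g → g :* (S.⟨ 1 ⟩ :- S.⟨ 1 ⟩) := S.⟨ 0 ⟩) refl g ⟩
        0#                      ∎
      same-value : value (quad x₀ x₁) z ≡ value (quad u₀ u₁) z
      same-value = x-y≡0⇒x≡y (trans
        (solve 5 (λ x₀ x₁ u₀ u₁ z → S.value (S.quad x₀ x₁) z :- S.value (S.quad u₀ u₁) z
                    := (x₁ :- u₁) :* z :+ (x₀ :- u₀)) refl x₀ x₁ u₀ u₁ z)
        linear-root)
      ΔB : value (quad y₀ y₁) z - value (quad v₀ v₁) z ≡ 0#
      ΔB = x≡y⇒x-y≡0 (*-cancelˡ (no-root z) (begin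
        value (quad x₀ x₁) z * value (quad y₀ y₁) z   ≡⟨ sym (value-*ₚ (quad x₀ x₁) (quad y₀ y₁) z) ⟩
        value (quad x₀ x₁ *ₚ quad y₀ y₁) z            ≡⟨ value-≈ₚ {quad x₀ x₁ *ₚ quad y₀ y₁} {quad u₀ u₁ *ₚ quad v₀ v₁} z XY≈UV ⟩
        value (quad u₀ u₁ *ₚ quad v₀ v₁) z            ≡⟨ value-*ₚ (quad u₀ u₁) (quad v₀ v₁) z ⟩
        value (quad u₀ u₁) z * value (quad v₀ v₁) z   ≡⟨ cong (_* value (quad v₀ v₁) z) (sym same-value) ⟩
        value (quad x₀ x₁) z * value (quad v₀ v₁) z   ∎))

  -- The two factorisations A B = U V have equal sums A + B = U + V, hence
  -- (A − U) (A − V) = A² − A (A + B) + A B = 0.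
  factor-of-product : ∀ {x₀ x₁ y₀ y₁ u₀ u₁ v₀ v₁} → (∀ z → value (quad x₀ x₁) z ≢ 0#) →
    quad x₀ x₁ *ₚ quad y₀ y₁ ≈ₚ quad u₀ u₁ *ₚ quad v₀ v₁ →
    (x₀ ≡ u₀ × x₁ ≡ u₁) ⊎ (x₀ ≡ v₀ × x₁ ≡ v₁)
  factor-of-product {x₀} {x₁} {y₀} {y₁} {u₀} {u₁} {v₀} {v₁} no-root XY≈UV =
    conclude (linear-product-zero {x₁ - u₁} {x₀ - u₀} {x₁ - v₁} {x₀ - v₀} ee′≡0 middle≡0 gg′≡0)
    where
    E : quadProduct x₀ x₁ y₀ y₁ ≈ₚ quadProduct u₀ u₁ v₀ v₁
    E = subst₂ _≈ₚ_ (quad-*ₚ-quad x₀ x₁ y₀ y₁) (quad-*ₚ-quad u₀ u₁ v₀ v₁) XY≈UV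
    ΔE₀ : (x₀ * y₀) - (u₀ * v₀) ≡ 0#
    ΔE₀ = x≡y⇒x-y≡0 (E 0)
    ΔE₁ : (x₀ * y₁ + x₁ * y₀) - (u₀ * v₁ + u₁ * v₀) ≡ 0#
    ΔE₁ = x≡y⇒x-y≡0 (E 1)
    ΔE₂ : (x₀ + y₀ + x₁ * y₁) - (u₀ + v₀ + u₁ * v₁) ≡ 0#
    ΔE₂ = x≡y⇒x-y≡0 (E 2)
    ΔS₁ : (x₁ + y₁) - (u₁ + v₁) ≡ 0#
    ΔS₁ = x≡y⇒x-y≡0 (E 3)

    ΔS₀ : (x₀ + y₀) - (u₀ + v₀) ≡ 0#
    ΔS₀ = equal-constant-sums {y₀ = y₀} {y₁} {u₀} {u₁} {v₀} {v₁} no-root XY≈UV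

    ee′≡0 : (x₁ - u₁) * (x₁ - v₁) ≡ 0#
    ee′≡0 = trans (solve 8 (λ x₀ x₁ y₀ y₁ u₀ u₁ v₀ v₁ → (x₁ :- u₁) :* (x₁ :- v₁)
                     := x₁ :* ((x₁ :+ y₁) :- (u₁ :+ v₁)) :+ (:- S.⟨ 1 ⟩) :* ((x₀ :+ y₀ :+ x₁ :* y₁) :- (u₀ :+ v₀ :+ u₁ :* v₁))
                        :+ S.⟨ 1 ⟩ :* ((x₀ :+ y₀) :- (u₀ :+ v₀))) refl x₀ x₁ y₀ y₁ u₀ u₁ v₀ v₁)
                  (combination-zero x₁ (- 1#) 1# ΔS₁ ΔE₂ ΔS₀)

    middle≡0 : (x₁ - u₁) * (x₀ - v₀) + (x₀ - u₀) * (x₁ - v₁) ≡ 0#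
    middle≡0 = trans (solve 8 (λ x₀ x₁ y₀ y₁ u₀ u₁ v₀ v₁ → (x₁ :- u₁) :* (x₀ :- v₀) :+ (x₀ :- u₀) :* (x₁ :- v₁)
                     := x₁ :* ((x₀ :+ y₀) :- (u₀ :+ v₀)) :+ x₀ :* ((x₁ :+ y₁) :- (u₁ :+ v₁))
                        :+ (:- S.⟨ 1 ⟩) :* ((x₀ :* y₁ :+ x₁ :* y₀) :- (u₀ :* v₁ :+ u₁ :* v₀))) refl x₀ x₁ y₀ y₁ u₀ u₁ v₀ v₁)
                  (combination-zero x₁ x₀ (- 1#) ΔS₀ ΔS₁ ΔE₁)

    gg′≡0 : (x₀ - u₀) * (x₀ - v₀) ≡ 0#
    gg′≡0 = trans (solve 8 (λ x₀ x₁ y₀ y₁ u₀ u₁ v₀ v₁ → (x₀ :- u₀) :* (x₀ :- v₀)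
                     := x₀ :* ((x₀ :+ y₀) :- (u₀ :+ v₀)) :+ (:- S.⟨ 1 ⟩) :* ((x₀ :* y₀) :- (u₀ :* v₀))
                        :+ S.⟨ 0 ⟩ :* S.⟨ 0 ⟩) refl x₀ x₁ y₀ y₁ u₀ u₁ v₀ v₁)
                  (combination-zero x₀ (- 1#) 0# ΔS₀ ΔE₀ refl)

    conclude : ((x₁ - u₁) ≡ 0# × (x₀ - u₀) ≡ 0#) ⊎ ((x₁ - v₁) ≡ 0# × (x₀ - v₀) ≡ 0#) →
               (x₀ ≡ u₀ × x₁ ≡ u₁) ⊎ (x₀ ≡ v₀ × x₁ ≡ v₁)
    conclude (inj₁ (e≡0 , g≡0)) = inj₁ (x-y≡0⇒x≡y g≡0 , x-y≡0⇒x≡y e≡0)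
    conclude (inj₂ (e′≡0 , g′≡0)) = inj₂ (x-y≡0⇒x≡y g′≡0 , x-y≡0⇒x≡y e′≡0)

module Invariants {q : ℕ} (F : FiniteField q) where
  open Arithmetic F
  open Polynomials F
  open Forms carrierSyntax
    using (matrix; det; adjugate; compose; denominator₃; cubic; U; R; Mden)
  open ≡-Reasoning
  private module S {n : ℕ} = Forms (solverSyntax n)

  monic : List Carrier → List Carrier
  monic X = quad (coeff X 2 ⁻¹ * coeff X 0) (coeff X 2 ⁻¹ * coeff X 1)

  monic-decomposition : ∀ {x₀ x₁ x₂} → x₂ ≢ 0# → x₀ ∷ x₁ ∷ x₂ ∷ [] ≡ scale x₂ (monic (x₀ ∷ x₁ ∷ x₂ ∷ []))
  monic-decomposition {x₀} {x₁} {x₂} x₂≢0 =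
    cong₂ _∷_ (cancel x₀) (cong₂ _∷_ (cancel x₁) (cong (_∷ []) (sym (*-identityʳ x₂))))
    where
    cancel : ∀ x → x ≡ x₂ * (x₂ ⁻¹ * x)
    cancel x = begin
      x                   ≡⟨ sym (*-identityˡ x) ⟩
      1# * x              ≡⟨ cong (_* x) (sym (⁻¹-inverse x₂ x₂≢0)) ⟩
      (x₂ * x₂ ⁻¹) * x    ≡⟨ *-assoc _ _ _ ⟩
      x₂ * (x₂ ⁻¹ * x)    ∎

  -- The leading coefficient of quad x₀ x₁ ∘ φ is c² · value (quad x₀ x₁) (a / c),
  -- or a² when c = 0.
  leading-coefficient≢0 : ∀ {x₀ x₁} φ → det φ ≢ 0# → (∀ z → value (quad x₀ x₁) z ≢ 0#) →
    coeff (compose 2 (quad x₀ x₁) φ) 2 ≢ 0#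
  leading-coefficient≢0 {x₀} {x₁} (matrix a b c d) det≢0 no-root lead≡0 with c ≟ 0#
  ... | yes c≡0 = det≢0 (trans
      (solve 4 (λ a b c d → a :* d :- b :* c := d :* a :+ (:- b) :* c :+ S.⟨ 0 ⟩ :* S.⟨ 0 ⟩) refl a b c d)
      (combination-zero d (- b) 0# a≡0 c≡0 refl))
    where
    a*a≡0 : a * a ≡ 0#
    a*a≡0 = trans
      (solve 6 (λ a b c d x₀ x₁ → a :* a
         := S.⟨ 1 ⟩ :* S.coeff (S.compose 2 (S.quad x₀ x₁) (S.matrix a b c d)) 2 :+ (:- (x₀ :* c :+ x₁ :* a)) :* c
            :+ S.⟨ 0 ⟩ :* S.⟨ 0 ⟩) refl a b c d x₀ x₁)
      (combination-zero 1# (- (x₀ * c + x₁ * a)) 0# lead≡0 c≡0 refl)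
    a≡0 : a ≡ 0#
    a≡0 with a ≟ 0#
    ... | yes a≡0 = a≡0
    ... | no a≢0 = ⊥-elim (x*y≢0 a≢0 a≢0 a*a≡0)
  ... | no c≢0 = no-root (a * c ⁻¹) (x*y≡0⇒y≡0 (x*y≢0 c≢0 c≢0) (trans
      (solve 7 (λ a b c d x₀ x₁ i → c :* c :* S.value (S.quad x₀ x₁) (a :* i)
         := S.⟨ 1 ⟩ :* S.coeff (S.compose 2 (S.quad x₀ x₁) (S.matrix a b c d)) 2
            :+ (x₁ :* a :* c :+ a :* a :* (c :* i :+ S.⟨ 1 ⟩)) :* (c :* i :- S.⟨ 1 ⟩) :+ S.⟨ 0 ⟩ :* S.⟨ 0 ⟩)
         refl a b c d x₀ x₁ (c ⁻¹))
      (combination-zero 1# (x₁ * a * c + a * a * (c * c ⁻¹ + 1#)) 0# lead≡0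
         (x≡y⇒x-y≡0 (⁻¹-inverse c c≢0)) refl)))

  record JointInvariant (I : List Carrier → List Carrier → Carrier) : Set where
    field
      scaleˡ : ∀ k {q₀ q₁ q₂ c₀ c₁ c₂ c₃} →
        I (scale k (q₀ ∷ q₁ ∷ q₂ ∷ [])) (cubic c₀ c₁ c₂ c₃) ≡ (k * k * k) * I (q₀ ∷ q₁ ∷ q₂ ∷ []) (cubic c₀ c₁ c₂ c₃)
      scaleʳ : ∀ k {q₀ q₁ q₂ c₀ c₁ c₂ c₃} →
        I (q₀ ∷ q₁ ∷ q₂ ∷ []) (scale k (cubic c₀ c₁ c₂ c₃)) ≡ (k * k) * I (q₀ ∷ q₁ ∷ q₂ ∷ []) (cubic c₀ c₁ c₂ c₃)
      compose-adjugate : ∀ φ x₀ x₁ →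
        I (compose 2 (quad x₀ x₁) φ) denominator₃ ≡ I (quad x₀ x₁) (compose 3 denominator₃ (adjugate φ))

  U-invariant : JointInvariant U
  U-invariant = record
    { scaleˡ = λ k {q₀ q₁ q₂ c₀ c₁ c₂ c₃} → solve 8 (λ k q₀ q₁ q₂ c₀ c₁ c₂ c₃ →
        S.U (S.scale k (q₀ ∷ q₁ ∷ q₂ ∷ [])) (S.cubic c₀ c₁ c₂ c₃) := (k :* k :* k) :* S.U (q₀ ∷ q₁ ∷ q₂ ∷ []) (S.cubic c₀ c₁ c₂ c₃))
        refl k q₀ q₁ q₂ c₀ c₁ c₂ c₃
    ; scaleʳ = λ k {q₀ q₁ q₂ c₀ c₁ c₂ c₃} → solve 8 (λ k q₀ q₁ q₂ c₀ c₁ c₂ c₃ →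
        S.U (q₀ ∷ q₁ ∷ q₂ ∷ []) (S.scale k (S.cubic c₀ c₁ c₂ c₃)) := (k :* k) :* S.U (q₀ ∷ q₁ ∷ q₂ ∷ []) (S.cubic c₀ c₁ c₂ c₃))
        refl k q₀ q₁ q₂ c₀ c₁ c₂ c₃
    ; compose-adjugate = λ { (matrix a b c d) x₀ x₁ → solve 6 (λ a b c d x₀ x₁ →
        S.U (S.compose 2 (S.quad x₀ x₁) (S.matrix a b c d)) S.denominator₃
        := S.U (S.quad x₀ x₁) (S.compose 3 S.denominator₃ (S.adjugate (S.matrix a b c d)))) refl a b c d x₀ x₁ }
    }

  R-invariant : JointInvariant R
  R-invariant = record
    { scaleˡ = λ k {q₀ q₁ q₂ c₀ c₁ c₂ c₃} → solve 8 (λ k q₀ q₁ q₂ c₀ c₁ c₂ c₃ →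
        S.R (S.scale k (q₀ ∷ q₁ ∷ q₂ ∷ [])) (S.cubic c₀ c₁ c₂ c₃) := (k :* k :* k) :* S.R (q₀ ∷ q₁ ∷ q₂ ∷ []) (S.cubic c₀ c₁ c₂ c₃))
        refl k q₀ q₁ q₂ c₀ c₁ c₂ c₃
    ; scaleʳ = λ k {q₀ q₁ q₂ c₀ c₁ c₂ c₃} → solve 8 (λ k q₀ q₁ q₂ c₀ c₁ c₂ c₃ →
        S.R (q₀ ∷ q₁ ∷ q₂ ∷ []) (S.scale k (S.cubic c₀ c₁ c₂ c₃)) := (k :* k) :* S.R (q₀ ∷ q₁ ∷ q₂ ∷ []) (S.cubic c₀ c₁ c₂ c₃))
        refl k q₀ q₁ q₂ c₀ c₁ c₂ c₃
    ; compose-adjugate = λ { (matrix a b c d) x₀ x₁ → solve 6 (λ a b c d x₀ x₁ →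
        S.R (S.compose 2 (S.quad x₀ x₁) (S.matrix a b c d)) S.denominator₃
        := S.R (S.quad x₀ x₁) (S.compose 3 S.denominator₃ (S.adjugate (S.matrix a b c d)))) refl a b c d x₀ x₁ }
    }

  -- M x y is u / (u − 8 r) for u = U (quad x y) (X² − X) and r = R (quad x y) (X² − X).
  M-from-invariants : ∀ {x y x′ y′} → Mden x y ≢ 0# → Mden x′ y′ ≢ 0# →
    U (quad x′ y′) denominator₃ * R (quad x y) denominator₃ ≡ R (quad x′ y′) denominator₃ * U (quad x y) denominator₃ →
    M x y ≡ M x′ y′
  M-from-invariants {x} {y} {x′} {y′} d≢0 d′≢0 U′R≡R′U = x*y′≡x′*y⇒x/y≡x′/y′ d≢0 d′≢0 (x-y≡0⇒x≡y (trans
    (solve 4 (λ x y x′ y′ → (S.Mnum x y :* S.Mden x′ y′) :- (S.Mnum x′ y′ :* S.Mden x y)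
       := S.⟨ 8 ⟩ :* ((S.U (S.quad x′ y′) S.denominator₃ :* S.R (S.quad x y) S.denominator₃)
                      :- (S.R (S.quad x′ y′) S.denominator₃ :* S.U (S.quad x y) S.denominator₃))
          :+ S.⟨ 0 ⟩ :* S.⟨ 0 ⟩ :+ S.⟨ 0 ⟩ :* S.⟨ 0 ⟩) refl x y x′ y′)
    (combination-zero (8 ×ₘ 1#) 0# 0# (x≡y⇒x-y≡0 U′R≡R′U) refl refl)))

  cubic-compose-adjugate : ∀ φ c₀ c₁ c₂ c₃ →
    compose 3 (compose 3 (cubic c₀ c₁ c₂ c₃) φ) (adjugate φ) ≈ₚ scale (det φ * det φ * det φ) (cubic c₀ c₁ c₂ c₃)
  cubic-compose-adjugate (matrix a b c d) c₀ c₁ c₂ c₃ 0 = solve 8 (λ a b c d c₀ c₁ c₂ c₃ →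
    S.coeff (S.compose 3 (S.compose 3 (S.cubic c₀ c₁ c₂ c₃) (S.matrix a b c d)) (S.adjugate (S.matrix a b c d))) 0
    := S.coeff (S.scale (S.det (S.matrix a b c d) :* S.det (S.matrix a b c d) :* S.det (S.matrix a b c d)) (S.cubic c₀ c₁ c₂ c₃)) 0)
    refl a b c d c₀ c₁ c₂ c₃
  cubic-compose-adjugate (matrix a b c d) c₀ c₁ c₂ c₃ 1 = solve 8 (λ a b c d c₀ c₁ c₂ c₃ →
    S.coeff (S.compose 3 (S.compose 3 (S.cubic c₀ c₁ c₂ c₃) (S.matrix a b c d)) (S.adjugate (S.matrix a b c d))) 1
    := S.coeff (S.scale (S.det (S.matrix a b c d) :* S.det (S.matrix a b c d) :* S.det (S.matrix a b c d)) (S.cubic c₀ c₁ c₂ c₃)) 1)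
    refl a b c d c₀ c₁ c₂ c₃
  cubic-compose-adjugate (matrix a b c d) c₀ c₁ c₂ c₃ 2 = solve 8 (λ a b c d c₀ c₁ c₂ c₃ →
    S.coeff (S.compose 3 (S.compose 3 (S.cubic c₀ c₁ c₂ c₃) (S.matrix a b c d)) (S.adjugate (S.matrix a b c d))) 2
    := S.coeff (S.scale (S.det (S.matrix a b c d) :* S.det (S.matrix a b c d) :* S.det (S.matrix a b c d)) (S.cubic c₀ c₁ c₂ c₃)) 2)
    refl a b c d c₀ c₁ c₂ c₃
  cubic-compose-adjugate (matrix a b c d) c₀ c₁ c₂ c₃ 3 = solve 8 (λ a b c d c₀ c₁ c₂ c₃ →
    S.coeff (S.compose 3 (S.compose 3 (S.cubic c₀ c₁ c₂ c₃) (S.matrix a b c d)) (S.adjugate (S.matrix a b c d))) 3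
    := S.coeff (S.scale (S.det (S.matrix a b c d) :* S.det (S.matrix a b c d) :* S.det (S.matrix a b c d)) (S.cubic c₀ c₁ c₂ c₃)) 3)
    refl a b c d c₀ c₁ c₂ c₃
  cubic-compose-adjugate (matrix a b c d) c₀ c₁ c₂ c₃ (suc (suc (suc (suc n)))) = refl

  compose-scale : ∀ l φ → compose 3 (scale l denominator₃) φ ≈ₚ scale l (compose 3 denominator₃ φ)
  compose-scale l (matrix a b c d) 0 = solve 5 (λ l a b c d →
    S.coeff (S.compose 3 (S.scale l S.denominator₃) (S.matrix a b c d)) 0
    := S.coeff (S.scale l (S.compose 3 S.denominator₃ (S.matrix a b c d))) 0) refl l a b c d
  compose-scale l (matrix a b c d) 1 = solve 5 (λ l a b c d →
    S.coeff (S.compose 3 (S.scale l S.denominator₃) (S.matrix a b c d)) 1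
    := S.coeff (S.scale l (S.compose 3 S.denominator₃ (S.matrix a b c d))) 1) refl l a b c d
  compose-scale l (matrix a b c d) 2 = solve 5 (λ l a b c d →
    S.coeff (S.compose 3 (S.scale l S.denominator₃) (S.matrix a b c d)) 2
    := S.coeff (S.scale l (S.compose 3 S.denominator₃ (S.matrix a b c d))) 2) refl l a b c d
  compose-scale l (matrix a b c d) 3 = solve 5 (λ l a b c d →
    S.coeff (S.compose 3 (S.scale l S.denominator₃) (S.matrix a b c d)) 3
    := S.coeff (S.scale l (S.compose 3 S.denominator₃ (S.matrix a b c d))) 3) refl l a b c d
  compose-scale l (matrix a b c d) (suc (suc (suc (suc n)))) = refl

  transport : ∀ {I} → JointInvariant I → ∀ {x₀ x₁ c₀ c₁ c₂ c₃} φ l →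
    let Δ = det φ
        X = compose 2 (quad x₀ x₁) φ
        X₂ = coeff X 2
    in X₂ ≢ 0# → compose 3 (cubic c₀ c₁ c₂ c₃) φ ≡ scale l denominator₃ →
       (Δ * Δ * Δ) * (Δ * Δ * Δ) * I (quad x₀ x₁) (cubic c₀ c₁ c₂ c₃)
         ≡ ((l * l) * (X₂ * X₂ * X₂)) * I (monic X) denominator₃
  transport {I} I-invariant {x₀} {x₁} {c₀} {c₁} {c₂} {c₃} φ l X₂≢0 C∘φ≡lD = begin
    (Δ * Δ * Δ) * (Δ * Δ * Δ) * I A C                     ≡⟨ sym (scaleʳ (Δ * Δ * Δ)) ⟩
    I A (scale (Δ * Δ * Δ) C)                             ≡⟨ cong (I A) (sym (≈ₚ⇒≡ refl (cubic-compose-adjugate φ c₀ c₁ c₂ c₃))) ⟩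
    I A (compose 3 (compose 3 C φ) (adjugate φ))          ≡⟨ cong (λ Z → I A (compose 3 Z (adjugate φ))) C∘φ≡lD ⟩
    I A (compose 3 (scale l denominator₃) (adjugate φ))   ≡⟨ cong (I A) (≈ₚ⇒≡ refl (compose-scale l (adjugate φ))) ⟩
    I A (scale l (compose 3 denominator₃ (adjugate φ)))   ≡⟨ scaleʳ l ⟩
    (l * l) * I A (compose 3 denominator₃ (adjugate φ))   ≡⟨ cong ((l * l) *_) (sym (compose-adjugate φ x₀ x₁)) ⟩
    (l * l) * I X denominator₃                            ≡⟨ cong (λ Y → (l * l) * I Y denominator₃) (monic-decomposition X₂≢0) ⟩
    (l * l) * I (scale X₂ (monic X)) denominator₃         ≡⟨ cong ((l * l) *_) (scaleˡ X₂) ⟩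
    (l * l) * ((X₂ * X₂ * X₂) * I (monic X) denominator₃) ≡⟨ sym (*-assoc _ _ _) ⟩
    ((l * l) * (X₂ * X₂ * X₂)) * I (monic X) denominator₃ ∎
    where
    open JointInvariant I-invariant
    Δ X₂ : Carrier
    A C X : List Carrier
    Δ = det φ
    A = quad x₀ x₁
    C = cubic c₀ c₁ c₂ c₃
    X = compose 2 A φ
    X₂ = coeff X 2

  proportion-scale : ∀ {x y u r} k → x * r ≡ y * u → (k * x) * r ≡ (k * y) * u
  proportion-scale {x} {y} {u} {r} k xr≡yu = begin
    (k * x) * r   ≡⟨ *-assoc k x r ⟩
    k * (x * r)   ≡⟨ cong (k *_) xr≡yu ⟩
    k * (y * u)   ≡⟨ sym (*-assoc k y u) ⟩
    (k * y) * u   ∎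

  proportion-cancel : ∀ {x y u r k} → k ≢ 0# → (k * x) * r ≡ (k * y) * u → x * r ≡ y * u
  proportion-cancel {x} {y} {u} {r} {k} k≢0 e =
    *-cancelˡ k≢0 (trans (sym (*-assoc k x r)) (trans e (*-assoc k y u)))

  invariants-transport : ∀ {x₀ x₁ c₀ c₁ c₂ c₃ u r} φ l → det φ ≢ 0# → l ≢ 0# →
    let X = compose 2 (quad x₀ x₁) φ
    in coeff X 2 ≢ 0# → compose 3 (cubic c₀ c₁ c₂ c₃) φ ≡ scale l denominator₃ →
       U (quad x₀ x₁) (cubic c₀ c₁ c₂ c₃) * r ≡ R (quad x₀ x₁) (cubic c₀ c₁ c₂ c₃) * u →
       U (monic X) denominator₃ * r ≡ R (monic X) denominator₃ * u
  invariants-transport φ l Δ≢0 l≢0 X₂≢0 C∘φ≡lD UR≡RU =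
    proportion-cancel (x*y≢0 (x*y≢0 l≢0 l≢0) (x*y≢0 (x*y≢0 X₂≢0 X₂≢0) X₂≢0))
      (subst₂ (λ x y → x * _ ≡ y * _)
        (transport U-invariant φ l X₂≢0 C∘φ≡lD) (transport R-invariant φ l X₂≢0 C∘φ≡lD)
        (proportion-scale ((det φ * det φ * det φ) * (det φ * det φ * det φ)) UR≡RU))

  invariants-cancel-scaling : ∀ {q₀ q₁ q₂ c₀ c₁ c₂ c₃ k m u r} → k ≢ 0# → m ≢ 0# →
    let Q = q₀ ∷ q₁ ∷ q₂ ∷ []
        C = cubic c₀ c₁ c₂ c₃
    in U (scale k Q) (scale m C) * r ≡ R (scale k Q) (scale m C) * u → U Q C * r ≡ R Q C * u
  invariants-cancel-scaling {k = k} {m} k≢0 m≢0 =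
    proportion-cancel (x*y≢0 (x*y≢0 (x*y≢0 k≢0 k≢0) k≢0) (x*y≢0 m≢0 m≢0))
      ∘ subst₂ (λ x y → x * _ ≡ y * _) (both-scaled U-invariant) (both-scaled R-invariant)
    where
    both-scaled : ∀ {I} → JointInvariant I → ∀ {q₀ q₁ q₂ c₀ c₁ c₂ c₃} →
      I (scale k (q₀ ∷ q₁ ∷ q₂ ∷ [])) (scale m (cubic c₀ c₁ c₂ c₃))
        ≡ ((k * k * k) * (m * m)) * I (q₀ ∷ q₁ ∷ q₂ ∷ []) (cubic c₀ c₁ c₂ c₃)
    both-scaled I-invariant = trans (scaleˡ k) (trans (cong ((k * k * k) *_) (scaleʳ m)) (sym (*-assoc _ _ _)))
      where open JointInvariant I-invariant

module Factorisations {q : ℕ} (F : FiniteField q) where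
  open Arithmetic F
  open Polynomials F
  open Invariants F
  open Forms carrierSyntax
    using (slope; Mden; pencil; numerator; denominator; denominator₃; scaledPencil; scaledPartner; U; R)
  open ≡-Reasoning
  private module S {n : ℕ} = Forms (solverSyntax n)

  record Factorisation (s t a₀ a₁ b₀ b₁ : Carrier) : Set where
    constructor mkFactorisation
    field
      b₁-formula : b₁ ≡ (- 2#) - a₁
      s-formula : s ≡ - ((a₀ + b₀) + a₁ * b₁)
      t-formula : t ≡ a₀ * b₀
      relation : b₀ * slope a₀ a₁ ≡ a₀ * (2# + a₁)

  factorisation : ∀ {s t a₀ a₁ b₀ b₁} → G s t ≈ₚ quad a₀ a₁ *ₚ quad b₀ b₁ → Factorisation s t a₀ a₁ b₀ b₁
  factorisation {s} {t} {a₀} {a₁} {b₀} {b₁} G≈AB = mkFactorisation b₁≡ s≡ (E 0) relation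
    where
    E : G s t ≈ₚ quadProduct a₀ a₁ b₀ b₁
    E n = trans (G≈AB n) (cong (λ P → coeff P n) (quad-*ₚ-quad a₀ a₁ b₀ b₁))
    b₁≡ : b₁ ≡ (- 2#) - a₁
    b₁≡ = x-y≡0⇒x≡y (trans
      (solve 2 (λ a₁ b₁ → b₁ :- ((:- S.⟨ 2 ⟩) :- a₁) := (a₁ :+ b₁) :- (:- S.⟨ 2 ⟩)) refl a₁ b₁)
      (x≡y⇒x-y≡0 (sym (E 3))))
    s≡ : s ≡ - ((a₀ + b₀) + a₁ * b₁)
    s≡ = trans (solve 1 (λ s → s := :- (:- s)) refl s) (cong -_ (E 2))
    relation : b₀ * slope a₀ a₁ ≡ a₀ * (2# + a₁)
    relation = x-y≡0⇒x≡y (trans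
      (solve 5 (λ a₀ a₁ b₀ b₁ t → (b₀ :* S.slope a₀ a₁) :- (a₀ :* (S.⟨ 2 ⟩ :+ a₁))
         := S.⟨ 1 ⟩ :* ((a₀ :* b₁ :+ a₁ :* b₀) :- (:- (S.⟨ 2 ⟩ :* t))) :+ (:- S.⟨ 2 ⟩) :* (t :- (a₀ :* b₀))
            :+ (:- a₀) :* (b₁ :- ((:- S.⟨ 2 ⟩) :- a₁))) refl a₀ a₁ b₀ b₁ t)
      (combination-zero 1# (- 2#) (- a₀) (x≡y⇒x-y≡0 (sym (E 1))) (x≡y⇒x-y≡0 (E 0)) (x≡y⇒x-y≡0 b₁≡)))

  module _ {s t a₀ a₁ b₀ b₁ : Carrier} (2≢0 : 2# ≢ 0#) (factors : Factorisation s t a₀ a₁ b₀ b₁)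
           (no-rootA : ∀ x → value (quad a₀ a₁) x ≢ 0#) (no-rootB : ∀ x → value (quad b₀ b₁) x ≢ 0#) where
    open Factorisation factors

    private
      Δ : (b₀ * slope a₀ a₁) - (a₀ * (2# + a₁)) ≡ 0#
      Δ = x≡y⇒x-y≡0 relation
      a₀≢0 : a₀ ≢ 0#
      a₀≢0 a₀≡0 = no-rootA 0# (trans (solve 2 (λ a₀ a₁ → S.value (S.quad a₀ a₁) S.⟨ 0 ⟩ := a₀) refl a₀ a₁) a₀≡0)
      b₀≢0 : b₀ ≢ 0#
      b₀≢0 b₀≡0 = no-rootB 0# (trans (solve 2 (λ b₀ b₁ → S.value (S.quad b₀ b₁) S.⟨ 0 ⟩ := b₀) refl b₀ b₁) b₀≡0)
      B[1] : value (quad b₀ b₁) 1# ≡ b₀ - (1# + a₁)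
      B[1] = trans (cong (λ b → value (quad b₀ b) 1#) b₁-formula)
        (solve 2 (λ a₁ b₀ → S.value (S.quad b₀ ((:- S.⟨ 2 ⟩) :- a₁)) S.⟨ 1 ⟩ := b₀ :- (S.⟨ 1 ⟩ :+ a₁)) refl a₁ b₀)

    -- Each factor of the denominator of M vanishes only when one of the two
    -- factors of G has the root 1.
    slope≢0 : slope a₀ a₁ ≢ 0#
    slope≢0 L≡0 = no-rootA 1# (x*y≡0⇒y≡0 (x*y≢0 2≢0 a₀≢0) (trans
      (solve 3 (λ a₀ a₁ b₀ → (S.⟨ 2 ⟩ :* a₀) :* S.value (S.quad a₀ a₁) S.⟨ 1 ⟩
         := (:- S.⟨ 1 ⟩) :* ((b₀ :* S.slope a₀ a₁) :- (a₀ :* (S.⟨ 2 ⟩ :+ a₁))) :+ (a₀ :+ b₀) :* S.slope a₀ a₁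
            :+ S.⟨ 0 ⟩ :* S.⟨ 0 ⟩) refl a₀ a₁ b₀)
      (combination-zero (- 1#) (a₀ + b₀) 0# Δ L≡0 refl)))

    Mden≢0 : Mden a₀ a₁ ≢ 0#
    Mden≢0 = x*y≢0 (x*y≢0 a₁≢0 2+a₁≢0) slope≢0
      where
      a₁≢0 : a₁ ≢ 0#
      a₁≢0 a₁≡0 = no-rootB 1# (trans B[1] (x*y≡0⇒y≡0 (x*y≢0 2≢0 a₀≢0) (trans
        (solve 3 (λ a₀ a₁ b₀ → (S.⟨ 2 ⟩ :* a₀) :* (b₀ :- (S.⟨ 1 ⟩ :+ a₁))
           := S.⟨ 1 ⟩ :* ((b₀ :* S.slope a₀ a₁) :- (a₀ :* (S.⟨ 2 ⟩ :+ a₁))) :+ (:- (a₀ :+ b₀)) :* a₁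
              :+ S.⟨ 0 ⟩ :* S.⟨ 0 ⟩) refl a₀ a₁ b₀)
        (combination-zero 1# (- (a₀ + b₀)) 0# Δ a₁≡0 refl))))
      2+a₁≢0 : 2# + a₁ ≢ 0#
      2+a₁≢0 2+a₁≡0 = no-rootA 1# (x*y≡0⇒y≡0 (x*y≢0 2≢0 b₀≢0) (trans
        (solve 3 (λ a₀ a₁ b₀ → (S.⟨ 2 ⟩ :* b₀) :* S.value (S.quad a₀ a₁) S.⟨ 1 ⟩
           := S.⟨ 1 ⟩ :* ((b₀ :* S.slope a₀ a₁) :- (a₀ :* (S.⟨ 2 ⟩ :+ a₁))) :+ (a₀ :+ b₀) :* (S.⟨ 2 ⟩ :+ a₁)
              :+ S.⟨ 0 ⟩ :* S.⟨ 0 ⟩) refl a₀ a₁ b₀)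
        (combination-zero 1# (a₀ + b₀) 0# Δ 2+a₁≡0 refl)))

  private
    scaled-pencil : ∀ a₀ a₁ b₀ γ δ →
      let s = - ((a₀ + b₀) + a₁ * ((- 2#) - a₁))
          t = a₀ * b₀
      in scale (slope a₀ a₁) (pencil γ δ (numerator s t) denominator) ≈ₚ scaledPencil a₀ a₁ (b₀ * slope a₀ a₁) γ δ
    scaled-pencil a₀ a₁ b₀ γ δ 0 = solve 5 (λ a₀ a₁ b₀ γ δ →
      S.coeff (S.scale (S.slope a₀ a₁) (S.pencil γ δ (S.numerator (:- ((a₀ :+ b₀) :+ a₁ :* ((:- S.⟨ 2 ⟩) :- a₁))) (a₀ :* b₀)) S.denominator)) 0
      := S.coeff (S.scaledPencil a₀ a₁ (b₀ :* S.slope a₀ a₁) γ δ) 0) refl a₀ a₁ b₀ γ δ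
    scaled-pencil a₀ a₁ b₀ γ δ 1 = solve 5 (λ a₀ a₁ b₀ γ δ →
      S.coeff (S.scale (S.slope a₀ a₁) (S.pencil γ δ (S.numerator (:- ((a₀ :+ b₀) :+ a₁ :* ((:- S.⟨ 2 ⟩) :- a₁))) (a₀ :* b₀)) S.denominator)) 1
      := S.coeff (S.scaledPencil a₀ a₁ (b₀ :* S.slope a₀ a₁) γ δ) 1) refl a₀ a₁ b₀ γ δ
    scaled-pencil a₀ a₁ b₀ γ δ 2 = solve 5 (λ a₀ a₁ b₀ γ δ →
      S.coeff (S.scale (S.slope a₀ a₁) (S.pencil γ δ (S.numerator (:- ((a₀ :+ b₀) :+ a₁ :* ((:- S.⟨ 2 ⟩) :- a₁))) (a₀ :* b₀)) S.denominator)) 2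
      := S.coeff (S.scaledPencil a₀ a₁ (b₀ :* S.slope a₀ a₁) γ δ) 2) refl a₀ a₁ b₀ γ δ
    scaled-pencil a₀ a₁ b₀ γ δ 3 = solve 5 (λ a₀ a₁ b₀ γ δ →
      S.coeff (S.scale (S.slope a₀ a₁) (S.pencil γ δ (S.numerator (:- ((a₀ :+ b₀) :+ a₁ :* ((:- S.⟨ 2 ⟩) :- a₁))) (a₀ :* b₀)) S.denominator)) 3
      := S.coeff (S.scaledPencil a₀ a₁ (b₀ :* S.slope a₀ a₁) γ δ) 3) refl a₀ a₁ b₀ γ δ
    scaled-pencil a₀ a₁ b₀ γ δ (suc (suc (suc (suc n)))) = refl

    scaled-partner : ∀ a₀ a₁ b₀ → scale (slope a₀ a₁) (quad b₀ ((- 2#) - a₁)) ≈ₚ scaledPartner a₀ a₁ (b₀ * slope a₀ a₁)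
    scaled-partner a₀ a₁ b₀ 0 = solve 3 (λ a₀ a₁ b₀ →
      S.coeff (S.scale (S.slope a₀ a₁) (S.quad b₀ ((:- S.⟨ 2 ⟩) :- a₁))) 0 := S.coeff (S.scaledPartner a₀ a₁ (b₀ :* S.slope a₀ a₁)) 0)
      refl a₀ a₁ b₀
    scaled-partner a₀ a₁ b₀ 1 = solve 3 (λ a₀ a₁ b₀ →
      S.coeff (S.scale (S.slope a₀ a₁) (S.quad b₀ ((:- S.⟨ 2 ⟩) :- a₁))) 1 := S.coeff (S.scaledPartner a₀ a₁ (b₀ :* S.slope a₀ a₁)) 1)
      refl a₀ a₁ b₀
    scaled-partner a₀ a₁ b₀ 2 = solve 3 (λ a₀ a₁ b₀ →
      S.coeff (S.scale (S.slope a₀ a₁) (S.quad b₀ ((:- S.⟨ 2 ⟩) :- a₁))) 2 := S.coeff (S.scaledPartner a₀ a₁ (b₀ :* S.slope a₀ a₁)) 2)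
      refl a₀ a₁ b₀
    scaled-partner a₀ a₁ b₀ (suc (suc (suc n))) = refl

  private
    scaled-pencil-relation : ∀ {a₀ a₁ b₀} γ δ → b₀ * slope a₀ a₁ ≡ a₀ * (2# + a₁) →
      let s = - ((a₀ + b₀) + a₁ * ((- 2#) - a₁))
          t = a₀ * b₀
      in scale (slope a₀ a₁) (pencil γ δ (numerator s t) denominator) ≡ scaledPencil a₀ a₁ (a₀ * (2# + a₁)) γ δ
    scaled-pencil-relation {a₀} {a₁} {b₀} γ δ relation =
      trans (≈ₚ⇒≡ refl (scaled-pencil a₀ a₁ b₀ γ δ)) (cong (λ w → scaledPencil a₀ a₁ w γ δ) relation)

  -- At a root x of a factor of G, a critical point of f = N / D, the pencil member
  -- γ N + δ D and its derivative are (γ f(x) + δ) D(x) and (γ f(x) + δ) D′(x), so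
  -- the ratio U : R of the factor against γ N + δ D is the one against D; that
  -- ratio is moreover the same for both factors.  After scaling by slope a₀ a₁
  -- this is a polynomial identity in a₀, a₁, γ, δ.
  pencil-invariance : ∀ {s t a₀ a₁ b₀ b₁ x₀ x₁} γ δ → Factorisation s t a₀ a₁ b₀ b₁ → slope a₀ a₁ ≢ 0# →
    (x₀ ≡ a₀ × x₁ ≡ a₁) ⊎ (x₀ ≡ b₀ × x₁ ≡ b₁) →
    let C = pencil γ δ (numerator s t) denominator
    in U (quad x₀ x₁) C * R (quad a₀ a₁) denominator₃ ≡ R (quad x₀ x₁) C * U (quad a₀ a₁) denominator₃
  pencil-invariance {a₀ = a₀} {a₁} {b₀} γ δ (mkFactorisation refl refl refl relation) L≢0 (inj₁ (refl , refl)) =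
    invariants-cancel-scaling (λ 1≡0 → 0≢1 (sym 1≡0)) L≢0
      (subst (λ C → U (scale 1# (quad a₀ a₁)) C * R (quad a₀ a₁) denominator₃ ≡ R (scale 1# (quad a₀ a₁)) C * U (quad a₀ a₁) denominator₃)
        (sym (scaled-pencil-relation γ δ relation))
        (solve 4 (λ a₀ a₁ γ δ →
           S.U (S.scale S.⟨ 1 ⟩ (S.quad a₀ a₁)) (S.scaledPencil a₀ a₁ (a₀ :* (S.⟨ 2 ⟩ :+ a₁)) γ δ) :* S.R (S.quad a₀ a₁) S.denominator₃
           := S.R (S.scale S.⟨ 1 ⟩ (S.quad a₀ a₁)) (S.scaledPencil a₀ a₁ (a₀ :* (S.⟨ 2 ⟩ :+ a₁)) γ δ) :* S.U (S.quad a₀ a₁) S.denominator₃)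
           refl a₀ a₁ γ δ))
  pencil-invariance {a₀ = a₀} {a₁} {b₀} γ δ (mkFactorisation refl refl refl relation) L≢0 (inj₂ (refl , refl)) =
    invariants-cancel-scaling L≢0 L≢0
      (subst₂ (λ Q C → U Q C * R (quad a₀ a₁) denominator₃ ≡ R Q C * U (quad a₀ a₁) denominator₃)
        (sym (trans (≈ₚ⇒≡ refl (scaled-partner a₀ a₁ b₀)) (cong (scaledPartner a₀ a₁) relation)))
        (sym (scaled-pencil-relation γ δ relation))
        (solve 4 (λ a₀ a₁ γ δ →
           S.U (S.scaledPartner a₀ a₁ (a₀ :* (S.⟨ 2 ⟩ :+ a₁))) (S.scaledPencil a₀ a₁ (a₀ :* (S.⟨ 2 ⟩ :+ a₁)) γ δ) :* S.R (S.quad a₀ a₁) S.denominator₃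
           := S.R (S.scaledPartner a₀ a₁ (a₀ :* (S.⟨ 2 ⟩ :+ a₁))) (S.scaledPencil a₀ a₁ (a₀ :* (S.⟨ 2 ⟩ :+ a₁)) γ δ) :* S.U (S.quad a₀ a₁) S.denominator₃)
           refl a₀ a₁ γ δ))

module Composites {q : ℕ} (F : FiniteField q) where
  open Arithmetic F
  open Polynomials F
  open Invariants F
  open Forms carrierSyntax
    using ( Matrix; matrix; det; compose; lowerRow; pencil; numerator; denominator; denominator₃
          ; cubic; crossRemainder; wronskian )
  open ≡-Reasoning
  private module S {n : ℕ} = Forms (solverSyntax n)

  matrixOf : Mobius → Matrix
  matrixOf (mob a b c d _) = matrix a b c d

  composite : Carrier → Carrier → Mobius → Mobius → List Carrier × List Carrier
  composite s t (mob α β γ δ _) φ =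
    compose 3 (pencil α β (numerator s t) denominator) (matrixOf φ) ,
    compose 3 (pencil γ δ (numerator s t) denominator) (matrixOf φ)

  -- precomp homogenises in degree 4, one more than the degree of f, which
  -- multiplies numerator and denominator by the lower row d + cX of φ.
  cross-multiplied : ∀ n s t s′ t′ ψ φ →
    coeff (numerator s′ t′ *ₚ proj₂ (postcomp ψ (precomp (f s t) φ))) n
      - coeff (proj₁ (postcomp ψ (precomp (f s t) φ)) *ₚ denominator) n
    ≡ coeff (lowerRow (matrixOf φ) *ₚ uncurry (crossRemainder s′ t′) (composite s t ψ φ)) n
  cross-multiplied 0 s t s′ t′ (mob α β γ δ _) (mob a b c d _) = solve 12 (λ s t s′ t′ α β γ δ a b c d →
    S.coeff (S.numerator s′ t′ S.*ₚ S.pencil γ δ (S.homog 4 (S.numerator s t) (b ∷ a ∷ []) (d ∷ c ∷ []))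
                                                 (S.homog 4 S.denominator (b ∷ a ∷ []) (d ∷ c ∷ []))) 0
      :- S.coeff (S.pencil α β (S.homog 4 (S.numerator s t) (b ∷ a ∷ []) (d ∷ c ∷ []))
                               (S.homog 4 S.denominator (b ∷ a ∷ []) (d ∷ c ∷ [])) S.*ₚ S.denominator) 0
    := S.coeff ((d ∷ c ∷ []) S.*ₚ S.crossRemainder s′ t′ (S.compose 3 (S.pencil α β (S.numerator s t) S.denominator) (S.matrix a b c d))
                                                          (S.compose 3 (S.pencil γ δ (S.numerator s t) S.denominator) (S.matrix a b c d))) 0)
    refl s t s′ t′ α β γ δ a b c d
  cross-multiplied 1 s t s′ t′ (mob α β γ δ _) (mob a b c d _) = solve 12 (λ s t s′ t′ α β γ δ a b c d →
    S.coeff (S.numerator s′ t′ S.*ₚ S.pencil γ δ (S.homog 4 (S.numerator s t) (b ∷ a ∷ []) (d ∷ c ∷ []))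
                                                 (S.homog 4 S.denominator (b ∷ a ∷ []) (d ∷ c ∷ []))) 1
      :- S.coeff (S.pencil α β (S.homog 4 (S.numerator s t) (b ∷ a ∷ []) (d ∷ c ∷ []))
                               (S.homog 4 S.denominator (b ∷ a ∷ []) (d ∷ c ∷ [])) S.*ₚ S.denominator) 1
    := S.coeff ((d ∷ c ∷ []) S.*ₚ S.crossRemainder s′ t′ (S.compose 3 (S.pencil α β (S.numerator s t) S.denominator) (S.matrix a b c d))
                                                          (S.compose 3 (S.pencil γ δ (S.numerator s t) S.denominator) (S.matrix a b c d))) 1)
    refl s t s′ t′ α β γ δ a b c d
  cross-multiplied 2 s t s′ t′ (mob α β γ δ _) (mob a b c d _) = solve 12 (λ s t s′ t′ α β γ δ a b c d →
    S.coeff (S.numerator s′ t′ S.*ₚ S.pencil γ δ (S.homog 4 (S.numerator s t) (b ∷ a ∷ []) (d ∷ c ∷ []))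
                                                 (S.homog 4 S.denominator (b ∷ a ∷ []) (d ∷ c ∷ []))) 2
      :- S.coeff (S.pencil α β (S.homog 4 (S.numerator s t) (b ∷ a ∷ []) (d ∷ c ∷ []))
                               (S.homog 4 S.denominator (b ∷ a ∷ []) (d ∷ c ∷ [])) S.*ₚ S.denominator) 2
    := S.coeff ((d ∷ c ∷ []) S.*ₚ S.crossRemainder s′ t′ (S.compose 3 (S.pencil α β (S.numerator s t) S.denominator) (S.matrix a b c d))
                                                          (S.compose 3 (S.pencil γ δ (S.numerator s t) S.denominator) (S.matrix a b c d))) 2)
    refl s t s′ t′ α β γ δ a b c d
  cross-multiplied 3 s t s′ t′ (mob α β γ δ _) (mob a b c d _) = solve 12 (λ s t s′ t′ α β γ δ a b c d →
    S.coeff (S.numerator s′ t′ S.*ₚ S.pencil γ δ (S.homog 4 (S.numerator s t) (b ∷ a ∷ []) (d ∷ c ∷ []))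
                                                 (S.homog 4 S.denominator (b ∷ a ∷ []) (d ∷ c ∷ []))) 3
      :- S.coeff (S.pencil α β (S.homog 4 (S.numerator s t) (b ∷ a ∷ []) (d ∷ c ∷ []))
                               (S.homog 4 S.denominator (b ∷ a ∷ []) (d ∷ c ∷ [])) S.*ₚ S.denominator) 3
    := S.coeff ((d ∷ c ∷ []) S.*ₚ S.crossRemainder s′ t′ (S.compose 3 (S.pencil α β (S.numerator s t) S.denominator) (S.matrix a b c d))
                                                          (S.compose 3 (S.pencil γ δ (S.numerator s t) S.denominator) (S.matrix a b c d))) 3)
    refl s t s′ t′ α β γ δ a b c d
  cross-multiplied 4 s t s′ t′ (mob α β γ δ _) (mob a b c d _) = solve 12 (λ s t s′ t′ α β γ δ a b c d →
    S.coeff (S.numerator s′ t′ S.*ₚ S.pencil γ δ (S.homog 4 (S.numerator s t) (b ∷ a ∷ []) (d ∷ c ∷ []))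
                                                 (S.homog 4 S.denominator (b ∷ a ∷ []) (d ∷ c ∷ []))) 4
      :- S.coeff (S.pencil α β (S.homog 4 (S.numerator s t) (b ∷ a ∷ []) (d ∷ c ∷ []))
                               (S.homog 4 S.denominator (b ∷ a ∷ []) (d ∷ c ∷ [])) S.*ₚ S.denominator) 4
    := S.coeff ((d ∷ c ∷ []) S.*ₚ S.crossRemainder s′ t′ (S.compose 3 (S.pencil α β (S.numerator s t) S.denominator) (S.matrix a b c d))
                                                          (S.compose 3 (S.pencil γ δ (S.numerator s t) S.denominator) (S.matrix a b c d))) 4)
    refl s t s′ t′ α β γ δ a b c d
  cross-multiplied 5 s t s′ t′ (mob α β γ δ _) (mob a b c d _) = solve 12 (λ s t s′ t′ α β γ δ a b c d →
    S.coeff (S.numerator s′ t′ S.*ₚ S.pencil γ δ (S.homog 4 (S.numerator s t) (b ∷ a ∷ []) (d ∷ c ∷ []))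
                                                 (S.homog 4 S.denominator (b ∷ a ∷ []) (d ∷ c ∷ []))) 5
      :- S.coeff (S.pencil α β (S.homog 4 (S.numerator s t) (b ∷ a ∷ []) (d ∷ c ∷ []))
                               (S.homog 4 S.denominator (b ∷ a ∷ []) (d ∷ c ∷ [])) S.*ₚ S.denominator) 5
    := S.coeff ((d ∷ c ∷ []) S.*ₚ S.crossRemainder s′ t′ (S.compose 3 (S.pencil α β (S.numerator s t) S.denominator) (S.matrix a b c d))
                                                          (S.compose 3 (S.pencil γ δ (S.numerator s t) S.denominator) (S.matrix a b c d))) 5)
    refl s t s′ t′ α β γ δ a b c d
  cross-multiplied 6 s t s′ t′ (mob α β γ δ _) (mob a b c d _) = solve 12 (λ s t s′ t′ α β γ δ a b c d →
    S.coeff (S.numerator s′ t′ S.*ₚ S.pencil γ δ (S.homog 4 (S.numerator s t) (b ∷ a ∷ []) (d ∷ c ∷ []))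
                                                 (S.homog 4 S.denominator (b ∷ a ∷ []) (d ∷ c ∷ []))) 6
      :- S.coeff (S.pencil α β (S.homog 4 (S.numerator s t) (b ∷ a ∷ []) (d ∷ c ∷ []))
                               (S.homog 4 S.denominator (b ∷ a ∷ []) (d ∷ c ∷ [])) S.*ₚ S.denominator) 6
    := S.coeff ((d ∷ c ∷ []) S.*ₚ S.crossRemainder s′ t′ (S.compose 3 (S.pencil α β (S.numerator s t) S.denominator) (S.matrix a b c d))
                                                          (S.compose 3 (S.pencil γ δ (S.numerator s t) S.denominator) (S.matrix a b c d))) 6)
    refl s t s′ t′ α β γ δ a b c d
  cross-multiplied 7 s t s′ t′ (mob α β γ δ _) (mob a b c d _) = solve 12 (λ s t s′ t′ α β γ δ a b c d →
    S.coeff (S.numerator s′ t′ S.*ₚ S.pencil γ δ (S.homog 4 (S.numerator s t) (b ∷ a ∷ []) (d ∷ c ∷ []))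
                                                 (S.homog 4 S.denominator (b ∷ a ∷ []) (d ∷ c ∷ []))) 7
      :- S.coeff (S.pencil α β (S.homog 4 (S.numerator s t) (b ∷ a ∷ []) (d ∷ c ∷ []))
                               (S.homog 4 S.denominator (b ∷ a ∷ []) (d ∷ c ∷ [])) S.*ₚ S.denominator) 7
    := S.coeff ((d ∷ c ∷ []) S.*ₚ S.crossRemainder s′ t′ (S.compose 3 (S.pencil α β (S.numerator s t) S.denominator) (S.matrix a b c d))
                                                          (S.compose 3 (S.pencil γ δ (S.numerator s t) S.denominator) (S.matrix a b c d))) 7)
    refl s t s′ t′ α β γ δ a b c d
  cross-multiplied (suc (suc (suc (suc (suc (suc (suc (suc n)))))))) s t s′ t′ ψ φ = -‿inverseʳ 0#

  cross-remainder-vanishes : ∀ {s t s′ t′} ψ φ → f s′ t′ ≈ᵣ postcomp ψ (precomp (f s t) φ) →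
    uncurry (crossRemainder s′ t′) (composite s t ψ φ) ≈ₚ []
  cross-remainder-vanishes {s} {t} {s′} {t′} ψ φ@(mob a b c d ad-bc≢0) eq =
    linear-factor-cancel (uncurry (crossRemainder s′ t′) (composite s t ψ φ)) c,d≢0 (λ n → trans (sym (cross-multiplied n s t s′ t′ ψ φ)) (x≡y⇒x-y≡0 (eq n)))
    where
    c,d≢0 : ¬ (c ≡ 0# × d ≡ 0#)
    c,d≢0 (refl , refl) = ad-bc≢0 (solve 2 (λ a b → a :* S.⟨ 0 ⟩ :- b :* S.⟨ 0 ⟩ := S.⟨ 0 ⟩) refl a b)

  -- r = N′Q - PD vanishes at 0 and 1 only through Q, so Q is a multiple of D
  -- and then P the same multiple of N′.
  proportional : ∀ {s′ t′ p₀ p₁ p₂ p₃ q₀ q₁ q₂ q₃} → t′ ≢ 0# → (1# + s′) + t′ ≢ 0# →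
    crossRemainder s′ t′ (cubic p₀ p₁ p₂ p₃) (cubic q₀ q₁ q₂ q₃) ≈ₚ [] →
    cubic p₀ p₁ p₂ p₃ ≡ scale q₂ (numerator s′ t′) × cubic q₀ q₁ q₂ q₃ ≡ scale q₂ denominator₃
  proportional {s′} {t′} {p₀} {p₁} {p₂} {p₃} {q₀} {q₁} {q₂} {q₃} t′≢0 N′[1]≢0 r≈0 =
    ≈ₚ⇒≡ refl P≈lN′ , ≈ₚ⇒≡ refl Q≈lD
    where
    rˢ : ∀ {n} → (s′ t′ p₀ p₁ p₂ p₃ q₀ q₁ q₂ q₃ : Polynomial n) → List (Polynomial n)
    rˢ s′ t′ p₀ p₁ p₂ p₃ q₀ q₁ q₂ q₃ = S.crossRemainder s′ t′ (S.cubic p₀ p₁ p₂ p₃) (S.cubic q₀ q₁ q₂ q₃)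

    q₀≡0 : q₀ ≡ 0#
    q₀≡0 = x*y≡0⇒y≡0 t′≢0 (trans
      (solve 10 (λ s′ t′ p₀ p₁ p₂ p₃ q₀ q₁ q₂ q₃ → t′ :* q₀
         := S.coeff (rˢ s′ t′ p₀ p₁ p₂ p₃ q₀ q₁ q₂ q₃) 0) refl s′ t′ p₀ p₁ p₂ p₃ q₀ q₁ q₂ q₃)
      (r≈0 0))
    Q[1]≡0 : q₀ + q₁ + q₂ + q₃ ≡ 0#
    Q[1]≡0 = x*y≡0⇒y≡0 N′[1]≢0 (trans
      (solve 10 (λ s′ t′ p₀ p₁ p₂ p₃ q₀ q₁ q₂ q₃ → ((S.⟨ 1 ⟩ :+ s′) :+ t′) :* (q₀ :+ q₁ :+ q₂ :+ q₃)
         := S.value (rˢ s′ t′ p₀ p₁ p₂ p₃ q₀ q₁ q₂ q₃) S.⟨ 1 ⟩) refl s′ t′ p₀ p₁ p₂ p₃ q₀ q₁ q₂ q₃)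
      (value-≈ₚ[] {crossRemainder s′ t′ (cubic p₀ p₁ p₂ p₃) (cubic q₀ q₁ q₂ q₃)} 1# r≈0))
    q₃≡0 : q₃ ≡ 0#
    q₃≡0 = trans
      (solve 10 (λ s′ t′ p₀ p₁ p₂ p₃ q₀ q₁ q₂ q₃ → q₃
         := S.coeff (rˢ s′ t′ p₀ p₁ p₂ p₃ q₀ q₁ q₂ q₃) 6) refl s′ t′ p₀ p₁ p₂ p₃ q₀ q₁ q₂ q₃)
      (r≈0 6)
    q₁+q₂≡0 : q₁ + q₂ ≡ 0#
    q₁+q₂≡0 = trans
      (solve 10 (λ s′ t′ p₀ p₁ p₂ p₃ q₀ q₁ q₂ q₃ → q₁ :+ q₂
         := S.⟨ 1 ⟩ :* (q₀ :+ q₁ :+ q₂ :+ q₃) :+ (:- S.⟨ 1 ⟩) :* q₀ :+ (:- S.⟨ 1 ⟩) :* q₃) refl s′ t′ p₀ p₁ p₂ p₃ q₀ q₁ q₂ q₃)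
      (combination-zero 1# (- 1#) (- 1#) Q[1]≡0 q₀≡0 q₃≡0)
    p₀≈ : p₀ - (q₂ * t′) ≡ 0#
    p₀≈ = trans
      (solve 10 (λ s′ t′ p₀ p₁ p₂ p₃ q₀ q₁ q₂ q₃ → p₀ :- q₂ :* t′
         := S.⟨ 1 ⟩ :* S.coeff (rˢ s′ t′ p₀ p₁ p₂ p₃ q₀ q₁ q₂ q₃) 1 :+ (:- t′) :* (q₁ :+ q₂) :+ (:- s′) :* q₀) refl s′ t′ p₀ p₁ p₂ p₃ q₀ q₁ q₂ q₃)
      (combination-zero 1# (- t′) (- s′) (r≈0 1) q₁+q₂≡0 q₀≡0)
    p₁≈ : p₁ - (q₂ * s′) ≡ 0#
    p₁≈ = trans
      (solve 10 (λ s′ t′ p₀ p₁ p₂ p₃ q₀ q₁ q₂ q₃ → p₁ :- q₂ :* s′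
         := S.⟨ 1 ⟩ :* S.coeff (rˢ s′ t′ p₀ p₁ p₂ p₃ q₀ q₁ q₂ q₃) 2 :+ S.⟨ 1 ⟩ :* (p₀ :- q₂ :* t′) :+ (:- s′) :* (q₁ :+ q₂)) refl s′ t′ p₀ p₁ p₂ p₃ q₀ q₁ q₂ q₃)
      (combination-zero 1# 1# (- s′) (r≈0 2) p₀≈ q₁+q₂≡0)
    q₁+p₃≡0 : q₁ + p₃ ≡ 0#
    q₁+p₃≡0 = trans
      (solve 10 (λ s′ t′ p₀ p₁ p₂ p₃ q₀ q₁ q₂ q₃ → q₁ :+ p₃
         := S.⟨ 1 ⟩ :* (q₁ :+ q₂) :+ (:- S.⟨ 1 ⟩) :* S.coeff (rˢ s′ t′ p₀ p₁ p₂ p₃ q₀ q₁ q₂ q₃) 5 :+ S.⟨ 0 ⟩ :* S.⟨ 0 ⟩) refl s′ t′ p₀ p₁ p₂ p₃ q₀ q₁ q₂ q₃)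
      (combination-zero 1# (- 1#) 0# q₁+q₂≡0 (r≈0 5) refl)
    p₂≈ : p₂ - (q₂ * 0#) ≡ 0#
    p₂≈ = trans
      (solve 10 (λ s′ t′ p₀ p₁ p₂ p₃ q₀ q₁ q₂ q₃ → p₂ :- q₂ :* S.⟨ 0 ⟩
         := (:- S.⟨ 1 ⟩) :* S.coeff (rˢ s′ t′ p₀ p₁ p₂ p₃ q₀ q₁ q₂ q₃) 4 :+ s′ :* q₃ :+ S.⟨ 1 ⟩ :* (q₁ :+ p₃)) refl s′ t′ p₀ p₁ p₂ p₃ q₀ q₁ q₂ q₃)
      (combination-zero (- 1#) s′ 1# (r≈0 4) q₃≡0 q₁+p₃≡0)
    p₃≈ : p₃ - (q₂ * 1#) ≡ 0#
    p₃≈ = trans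
      (solve 10 (λ s′ t′ p₀ p₁ p₂ p₃ q₀ q₁ q₂ q₃ → p₃ :- q₂ :* S.⟨ 1 ⟩
         := (:- S.⟨ 1 ⟩) :* S.coeff (rˢ s′ t′ p₀ p₁ p₂ p₃ q₀ q₁ q₂ q₃) 5 :+ S.⟨ 0 ⟩ :* S.⟨ 0 ⟩ :+ S.⟨ 0 ⟩ :* S.⟨ 0 ⟩) refl s′ t′ p₀ p₁ p₂ p₃ q₀ q₁ q₂ q₃)
      (combination-zero (- 1#) 0# 0# (r≈0 5) refl refl)

    P≈lN′ : cubic p₀ p₁ p₂ p₃ ≈ₚ scale q₂ (numerator s′ t′)
    P≈lN′ 0 = x-y≡0⇒x≡y p₀≈
    P≈lN′ 1 = x-y≡0⇒x≡y p₁≈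
    P≈lN′ 2 = x-y≡0⇒x≡y p₂≈
    P≈lN′ 3 = x-y≡0⇒x≡y p₃≈
    P≈lN′ (suc (suc (suc (suc n)))) = refl

    Q≈lD : cubic q₀ q₁ q₂ q₃ ≈ₚ scale q₂ denominator₃
    Q≈lD 0 = x-y≡0⇒x≡y (trans (solve 2 (λ q₀ q₂ → q₀ :- q₂ :* S.⟨ 0 ⟩ := q₀) refl q₀ q₂) q₀≡0)
    Q≈lD 1 = x-y≡0⇒x≡y (trans (solve 2 (λ q₁ q₂ → q₁ :- q₂ :* (:- S.⟨ 1 ⟩) := q₁ :+ q₂) refl q₁ q₂) q₁+q₂≡0)
    Q≈lD 2 = solve 1 (λ q₂ → q₂ := q₂ :* S.⟨ 1 ⟩) refl q₂
    Q≈lD 3 = x-y≡0⇒x≡y (trans (solve 2 (λ q₃ q₂ → q₃ :- q₂ :* S.⟨ 0 ⟩ := q₃) refl q₃ q₂) q₃≡0)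
    Q≈lD (suc (suc (suc (suc n)))) = refl

  wronskian-composite : ∀ s t ψ φ →
    uncurry wronskian (composite s t ψ φ) ≈ₚ scale (det (matrixOf ψ) * det (matrixOf φ)) (compose 4 (G s t) (matrixOf φ))
  wronskian-composite s t (mob α β γ δ _) (mob a b c d _) 0 = solve 10 (λ s t α β γ δ a b c d →
    S.coeff (S.wronskian (S.compose 3 (S.pencil α β (S.numerator s t) S.denominator) (S.matrix a b c d))
                         (S.compose 3 (S.pencil γ δ (S.numerator s t) S.denominator) (S.matrix a b c d))) 0
    := S.coeff (S.scale (S.det (S.matrix α β γ δ) :* S.det (S.matrix a b c d)) (S.compose 4 (S.G s t) (S.matrix a b c d))) 0)
    refl s t α β γ δ a b c d
  wronskian-composite s t (mob α β γ δ _) (mob a b c d _) 1 = solve 10 (λ s t α β γ δ a b c d →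
    S.coeff (S.wronskian (S.compose 3 (S.pencil α β (S.numerator s t) S.denominator) (S.matrix a b c d))
                         (S.compose 3 (S.pencil γ δ (S.numerator s t) S.denominator) (S.matrix a b c d))) 1
    := S.coeff (S.scale (S.det (S.matrix α β γ δ) :* S.det (S.matrix a b c d)) (S.compose 4 (S.G s t) (S.matrix a b c d))) 1)
    refl s t α β γ δ a b c d
  wronskian-composite s t (mob α β γ δ _) (mob a b c d _) 2 = solve 10 (λ s t α β γ δ a b c d →
    S.coeff (S.wronskian (S.compose 3 (S.pencil α β (S.numerator s t) S.denominator) (S.matrix a b c d))
                         (S.compose 3 (S.pencil γ δ (S.numerator s t) S.denominator) (S.matrix a b c d))) 2
    := S.coeff (S.scale (S.det (S.matrix α β γ δ) :* S.det (S.matrix a b c d)) (S.compose 4 (S.G s t) (S.matrix a b c d))) 2)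
    refl s t α β γ δ a b c d
  wronskian-composite s t (mob α β γ δ _) (mob a b c d _) 3 = solve 10 (λ s t α β γ δ a b c d →
    S.coeff (S.wronskian (S.compose 3 (S.pencil α β (S.numerator s t) S.denominator) (S.matrix a b c d))
                         (S.compose 3 (S.pencil γ δ (S.numerator s t) S.denominator) (S.matrix a b c d))) 3
    := S.coeff (S.scale (S.det (S.matrix α β γ δ) :* S.det (S.matrix a b c d)) (S.compose 4 (S.G s t) (S.matrix a b c d))) 3)
    refl s t α β γ δ a b c d
  wronskian-composite s t (mob α β γ δ _) (mob a b c d _) 4 = solve 10 (λ s t α β γ δ a b c d →
    S.coeff (S.wronskian (S.compose 3 (S.pencil α β (S.numerator s t) S.denominator) (S.matrix a b c d))
                         (S.compose 3 (S.pencil γ δ (S.numerator s t) S.denominator) (S.matrix a b c d))) 4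
    := S.coeff (S.scale (S.det (S.matrix α β γ δ) :* S.det (S.matrix a b c d)) (S.compose 4 (S.G s t) (S.matrix a b c d))) 4)
    refl s t α β γ δ a b c d
  wronskian-composite s t (mob α β γ δ _) (mob a b c d _) 5 = solve 10 (λ s t α β γ δ a b c d →
    S.coeff (S.wronskian (S.compose 3 (S.pencil α β (S.numerator s t) S.denominator) (S.matrix a b c d))
                         (S.compose 3 (S.pencil γ δ (S.numerator s t) S.denominator) (S.matrix a b c d))) 5
    := S.coeff (S.scale (S.det (S.matrix α β γ δ) :* S.det (S.matrix a b c d)) (S.compose 4 (S.G s t) (S.matrix a b c d))) 5)
    refl s t α β γ δ a b c d
  wronskian-composite s t (mob α β γ δ _) (mob a b c d _) (suc (suc (suc (suc (suc (suc n)))))) = refl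

  wronskian-scaled : ∀ l s t → wronskian (scale l (numerator s t)) (scale l denominator₃) ≈ₚ scale (l * l) (G s t)
  wronskian-scaled l s t 0 = solve 3 (λ l s t →
    S.coeff (S.wronskian (S.scale l (S.numerator s t)) (S.scale l S.denominator₃)) 0 := S.coeff (S.scale (l :* l) (S.G s t)) 0)
    refl l s t
  wronskian-scaled l s t 1 = solve 3 (λ l s t →
    S.coeff (S.wronskian (S.scale l (S.numerator s t)) (S.scale l S.denominator₃)) 1 := S.coeff (S.scale (l :* l) (S.G s t)) 1)
    refl l s t
  wronskian-scaled l s t 2 = solve 3 (λ l s t →
    S.coeff (S.wronskian (S.scale l (S.numerator s t)) (S.scale l S.denominator₃)) 2 := S.coeff (S.scale (l :* l) (S.G s t)) 2)
    refl l s t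
  wronskian-scaled l s t 3 = solve 3 (λ l s t →
    S.coeff (S.wronskian (S.scale l (S.numerator s t)) (S.scale l S.denominator₃)) 3 := S.coeff (S.scale (l :* l) (S.G s t)) 3)
    refl l s t
  wronskian-scaled l s t 4 = solve 3 (λ l s t →
    S.coeff (S.wronskian (S.scale l (S.numerator s t)) (S.scale l S.denominator₃)) 4 := S.coeff (S.scale (l :* l) (S.G s t)) 4)
    refl l s t
  wronskian-scaled l s t 5 = solve 3 (λ l s t →
    S.coeff (S.wronskian (S.scale l (S.numerator s t)) (S.scale l S.denominator₃)) 5 := S.coeff (S.scale (l :* l) (S.G s t)) 5)
    refl l s t
  wronskian-scaled l s t (suc (suc (suc (suc (suc (suc n)))))) = refl

  compose-quad-product : ∀ φ a₀ a₁ b₀ b₁ →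
    compose 4 (quad a₀ a₁ *ₚ quad b₀ b₁) φ ≈ₚ compose 2 (quad a₀ a₁) φ *ₚ compose 2 (quad b₀ b₁) φ
  compose-quad-product (matrix a b c d) a₀ a₁ b₀ b₁ 0 = solve 8 (λ a b c d a₀ a₁ b₀ b₁ →
    S.coeff (S.compose 4 (S.quad a₀ a₁ S.*ₚ S.quad b₀ b₁) (S.matrix a b c d)) 0
    := S.coeff (S.compose 2 (S.quad a₀ a₁) (S.matrix a b c d) S.*ₚ S.compose 2 (S.quad b₀ b₁) (S.matrix a b c d)) 0)
    refl a b c d a₀ a₁ b₀ b₁
  compose-quad-product (matrix a b c d) a₀ a₁ b₀ b₁ 1 = solve 8 (λ a b c d a₀ a₁ b₀ b₁ →
    S.coeff (S.compose 4 (S.quad a₀ a₁ S.*ₚ S.quad b₀ b₁) (S.matrix a b c d)) 1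
    := S.coeff (S.compose 2 (S.quad a₀ a₁) (S.matrix a b c d) S.*ₚ S.compose 2 (S.quad b₀ b₁) (S.matrix a b c d)) 1)
    refl a b c d a₀ a₁ b₀ b₁
  compose-quad-product (matrix a b c d) a₀ a₁ b₀ b₁ 2 = solve 8 (λ a b c d a₀ a₁ b₀ b₁ →
    S.coeff (S.compose 4 (S.quad a₀ a₁ S.*ₚ S.quad b₀ b₁) (S.matrix a b c d)) 2
    := S.coeff (S.compose 2 (S.quad a₀ a₁) (S.matrix a b c d) S.*ₚ S.compose 2 (S.quad b₀ b₁) (S.matrix a b c d)) 2)
    refl a b c d a₀ a₁ b₀ b₁
  compose-quad-product (matrix a b c d) a₀ a₁ b₀ b₁ 3 = solve 8 (λ a b c d a₀ a₁ b₀ b₁ →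
    S.coeff (S.compose 4 (S.quad a₀ a₁ S.*ₚ S.quad b₀ b₁) (S.matrix a b c d)) 3
    := S.coeff (S.compose 2 (S.quad a₀ a₁) (S.matrix a b c d) S.*ₚ S.compose 2 (S.quad b₀ b₁) (S.matrix a b c d)) 3)
    refl a b c d a₀ a₁ b₀ b₁
  compose-quad-product (matrix a b c d) a₀ a₁ b₀ b₁ 4 = solve 8 (λ a b c d a₀ a₁ b₀ b₁ →
    S.coeff (S.compose 4 (S.quad a₀ a₁ S.*ₚ S.quad b₀ b₁) (S.matrix a b c d)) 4
    := S.coeff (S.compose 2 (S.quad a₀ a₁) (S.matrix a b c d) S.*ₚ S.compose 2 (S.quad b₀ b₁) (S.matrix a b c d)) 4)
    refl a b c d a₀ a₁ b₀ b₁
  compose-quad-product (matrix a b c d) a₀ a₁ b₀ b₁ (suc (suc (suc (suc (suc n))))) = refl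

  scale-quad-product : ∀ x y a₀ a₁ b₀ b₁ →
    scale x (quad a₀ a₁) *ₚ scale y (quad b₀ b₁) ≈ₚ scale (x * y) (quad a₀ a₁ *ₚ quad b₀ b₁)
  scale-quad-product x y a₀ a₁ b₀ b₁ 0 = solve 6 (λ x y a₀ a₁ b₀ b₁ →
    S.coeff (S.scale x (S.quad a₀ a₁) S.*ₚ S.scale y (S.quad b₀ b₁)) 0 := S.coeff (S.scale (x :* y) (S.quad a₀ a₁ S.*ₚ S.quad b₀ b₁)) 0)
    refl x y a₀ a₁ b₀ b₁
  scale-quad-product x y a₀ a₁ b₀ b₁ 1 = solve 6 (λ x y a₀ a₁ b₀ b₁ →
    S.coeff (S.scale x (S.quad a₀ a₁) S.*ₚ S.scale y (S.quad b₀ b₁)) 1 := S.coeff (S.scale (x :* y) (S.quad a₀ a₁ S.*ₚ S.quad b₀ b₁)) 1)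
    refl x y a₀ a₁ b₀ b₁
  scale-quad-product x y a₀ a₁ b₀ b₁ 2 = solve 6 (λ x y a₀ a₁ b₀ b₁ →
    S.coeff (S.scale x (S.quad a₀ a₁) S.*ₚ S.scale y (S.quad b₀ b₁)) 2 := S.coeff (S.scale (x :* y) (S.quad a₀ a₁ S.*ₚ S.quad b₀ b₁)) 2)
    refl x y a₀ a₁ b₀ b₁
  scale-quad-product x y a₀ a₁ b₀ b₁ 3 = solve 6 (λ x y a₀ a₁ b₀ b₁ →
    S.coeff (S.scale x (S.quad a₀ a₁) S.*ₚ S.scale y (S.quad b₀ b₁)) 3 := S.coeff (S.scale (x :* y) (S.quad a₀ a₁ S.*ₚ S.quad b₀ b₁)) 3)
    refl x y a₀ a₁ b₀ b₁
  scale-quad-product x y a₀ a₁ b₀ b₁ 4 = solve 6 (λ x y a₀ a₁ b₀ b₁ →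
    S.coeff (S.scale x (S.quad a₀ a₁) S.*ₚ S.scale y (S.quad b₀ b₁)) 4 := S.coeff (S.scale (x :* y) (S.quad a₀ a₁ S.*ₚ S.quad b₀ b₁)) 4)
    refl x y a₀ a₁ b₀ b₁
  scale-quad-product x y a₀ a₁ b₀ b₁ (suc (suc (suc (suc (suc n))))) = refl

  pullback : Mobius → Carrier → Carrier → List Carrier
  pullback φ x₀ x₁ = monic (compose 2 (quad x₀ x₁) (matrixOf φ))

module Equivalence {q : ℕ} (F : FiniteField q) where
  open Arithmetic F
  open Polynomials F
  open Invariants F
  open Factorisations F
  open Composites F
  open Forms carrierSyntax
    using (det; compose; pencil; numerator; denominator; denominator₃; wronskian; slope; U; R)
  open import Relation.Binary.Reasoning.Setoid ≈ₚ-setoid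

  module _ {s t s′ t′ : Carrier} (ψ φ : Mobius) (N′[0]N′[1]≢0 : t′ * ((1# + s′) + t′) ≢ 0#)
           (equivalent : f s′ t′ ≈ᵣ postcomp ψ (precomp (f s t) φ)) where

    l : Carrier
    l = coeff (proj₂ (composite s t ψ φ)) 2

    composite-proportional :
      proj₁ (composite s t ψ φ) ≡ scale l (numerator s′ t′) × proj₂ (composite s t ψ φ) ≡ scale l denominator₃
    composite-proportional = proportional (x*y≢0⇒x≢0 N′[0]N′[1]≢0) (x*y≢0⇒y≢0 N′[0]N′[1]≢0)
      (cross-remainder-vanishes ψ φ equivalent)

    module _ {a₀ a₁ b₀ b₁ : Carrier} (G≈AB : G s t ≈ₚ quad a₀ a₁ *ₚ quad b₀ b₁)
             (no-rootA : ∀ x → value (quad a₀ a₁) x ≢ 0#) (no-rootB : ∀ x → value (quad b₀ b₁) x ≢ 0#) where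

      Â B̂ : List Carrier
      Â = pullback φ a₀ a₁
      B̂ = pullback φ b₀ b₁

      A₂ B₂ Δ μ : Carrier
      A₂ = coeff (compose 2 (quad a₀ a₁) (matrixOf φ)) 2
      B₂ = coeff (compose 2 (quad b₀ b₁) (matrixOf φ)) 2
      Δ = det (matrixOf ψ) * det (matrixOf φ)
      μ = Δ * (A₂ * B₂)

      A₂≢0 : A₂ ≢ 0#
      A₂≢0 = leading-coefficient≢0 (matrixOf φ) (Mobius.det≢0 φ) no-rootA

      B₂≢0 : B₂ ≢ 0#
      B₂≢0 = leading-coefficient≢0 (matrixOf φ) (Mobius.det≢0 φ) no-rootB

      -- the Wronskians of both sides of f s′ t′ = ψ ∘ f s t ∘ φ
      wronskian-identity : scale (l * l) (G s′ t′) ≈ₚ scale μ (Â *ₚ B̂)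
      wronskian-identity = begin
        scale (l * l) (G s′ t′)
          ≈⟨ (λ n → sym (wronskian-scaled l s′ t′ n)) ⟩
        wronskian (scale l (numerator s′ t′)) (scale l denominator₃)
          ≡⟨ sym (cong₂ wronskian (proj₁ composite-proportional) (proj₂ composite-proportional)) ⟩
        uncurry wronskian (composite s t ψ φ)
          ≈⟨ wronskian-composite s t ψ φ ⟩
        scale Δ (compose 4 (G s t) (matrixOf φ))
          ≡⟨ cong (λ X → scale Δ (compose 4 X (matrixOf φ))) (≈ₚ⇒≡ {G s t} {quad a₀ a₁ *ₚ quad b₀ b₁} refl G≈AB) ⟩
        scale Δ (compose 4 (quad a₀ a₁ *ₚ quad b₀ b₁) (matrixOf φ))
          ≈⟨ scale-cong Δ (compose 4 (quad a₀ a₁ *ₚ quad b₀ b₁) (matrixOf φ)) (compose 2 (quad a₀ a₁) (matrixOf φ) *ₚ compose 2 (quad b₀ b₁) (matrixOf φ))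
               (compose-quad-product (matrixOf φ) a₀ a₁ b₀ b₁) ⟩
        scale Δ (compose 2 (quad a₀ a₁) (matrixOf φ) *ₚ compose 2 (quad b₀ b₁) (matrixOf φ))
          ≡⟨ cong₂ (λ X Y → scale Δ (X *ₚ Y)) (monic-decomposition A₂≢0) (monic-decomposition B₂≢0) ⟩
        scale Δ (scale A₂ Â *ₚ scale B₂ B̂)
          ≈⟨ scale-cong Δ (scale A₂ Â *ₚ scale B₂ B̂) (scale (A₂ * B₂) (Â *ₚ B̂))
               (scale-quad-product A₂ B₂ (coeff Â 0) (coeff Â 1) (coeff B̂ 0) (coeff B̂ 1)) ⟩
        scale Δ (scale (A₂ * B₂) (Â *ₚ B̂))
          ≈⟨ scale-scale Δ (A₂ * B₂) (Â *ₚ B̂) ⟩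
        scale μ (Â *ₚ B̂) ∎

      l*l≡μ : l * l ≡ μ
      l*l≡μ = trans (sym (*-identityʳ (l * l))) (trans (wronskian-identity 4)
        (trans (cong (λ X → coeff (scale μ X) 4) (quad-*ₚ-quad (coeff Â 0) (coeff Â 1) (coeff B̂ 0) (coeff B̂ 1)))
               (*-identityʳ μ)))

      μ≢0 : μ ≢ 0#
      μ≢0 = x*y≢0 (x*y≢0 (Mobius.det≢0 ψ) (Mobius.det≢0 φ)) (x*y≢0 A₂≢0 B₂≢0)

      l≢0 : l ≢ 0#
      l≢0 = x*y≢0⇒x≢0 (λ l*l≡0 → μ≢0 (trans (sym l*l≡μ) l*l≡0))

      G′≈ÂB̂ : G s′ t′ ≈ₚ Â *ₚ B̂
      G′≈ÂB̂ = scale-cancel (G s′ t′) (Â *ₚ B̂) μ≢0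
        (subst (λ k → scale k (G s′ t′) ≈ₚ scale μ (Â *ₚ B̂)) l*l≡μ wronskian-identity)

      -- quad a₀′ a₁′ is the pullback of a factor of G s t, and φ pulls the pencil
      -- member γ N + δ D back to l (X² − X).
      invariant-preserved : ∀ {a₀′ a₁′ b₀′ b₁′} → Factorisation s t a₀ a₁ b₀ b₁ → slope a₀ a₁ ≢ 0# →
        G s′ t′ ≈ₚ quad a₀′ a₁′ *ₚ quad b₀′ b₁′ → (∀ x → value (quad a₀′ a₁′) x ≢ 0#) →
        U (quad a₀′ a₁′) denominator₃ * R (quad a₀ a₁) denominator₃
          ≡ R (quad a₀′ a₁′) denominator₃ * U (quad a₀ a₁) denominator₃
      invariant-preserved {a₀′} {a₁′} {b₀′} {b₁′} factors L≢0 G′≈A′B′ no-rootA′ =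
        [ from-match A₂≢0 (inj₁ (refl , refl)) , from-match B₂≢0 (inj₂ (refl , refl)) ]
          (factor-of-product {a₀′} {a₁′} {b₀′} {b₁′} {coeff Â 0} {coeff Â 1} {coeff B̂ 0} {coeff B̂ 1}
             no-rootA′ A′B′≈ÂB̂)
        where
        A′B′≈ÂB̂ : quad a₀′ a₁′ *ₚ quad b₀′ b₁′ ≈ₚ Â *ₚ B̂
        A′B′≈ÂB̂ n = trans (sym (G′≈A′B′ n)) (G′≈ÂB̂ n)
        C : List Carrier
        C = pencil (Mobius.c ψ) (Mobius.d ψ) (numerator s t) denominator
        u r : Carrier
        u = U (quad a₀ a₁) denominator₃
        r = R (quad a₀ a₁) denominator₃
        from-match : ∀ {x₀ x₁} → coeff (compose 2 (quad x₀ x₁) (matrixOf φ)) 2 ≢ 0# →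
          (x₀ ≡ a₀ × x₁ ≡ a₁) ⊎ (x₀ ≡ b₀ × x₁ ≡ b₁) →
          a₀′ ≡ coeff (pullback φ x₀ x₁) 0 × a₁′ ≡ coeff (pullback φ x₀ x₁) 1 →
          U (quad a₀′ a₁′) denominator₃ * r ≡ R (quad a₀′ a₁′) denominator₃ * u
        from-match {x₀} {x₁} X₂≢0 factor (a₀′≡ , a₁′≡) =
          subst (λ Y → U Y denominator₃ * r ≡ R Y denominator₃ * u) (sym (cong₂ quad a₀′≡ a₁′≡))
            (invariants-transport {x₀} {x₁} {coeff C 0} {coeff C 1} {coeff C 2} {coeff C 3} {u} {r}
               (matrixOf φ) l (Mobius.det≢0 φ) l≢0 X₂≢0 (proj₂ composite-proportional)
               (pencil-invariance {x₀ = x₀} {x₁} (Mobius.c ψ) (Mobius.d ψ) factors L≢0 factor))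

theorem6p16 : (p k q : ℕ) → Prime p → 5 ≤ p → q ≡ p ^ k → (F : FiniteField q) →
    let open Over F in
    (s t s′ t′ a₀ a₁ b₀ b₁ a₀′ a₁′ b₀′ b₁′ : Carrier) →
    t * ((1# + s) + t) ≢ 0# → t′ * ((1# + s′) + t′) ≢ 0# →
    Equivalent (f s t) (f s′ t′) →
    G s t ≈ₚ quad a₀ a₁ *ₚ quad b₀ b₁ →
    ¬ (quad a₀ a₁ ≈ₚ quad b₀ b₁) → Irreducible (quad a₀ a₁) → Irreducible (quad b₀ b₁) →
    G s′ t′ ≈ₚ quad a₀′ a₁′ *ₚ quad b₀′ b₁′ →
    ¬ (quad a₀′ a₁′ ≈ₚ quad b₀′ b₁′) → Irreducible (quad a₀′ a₁′) → Irreducible (quad b₀′ b₁′) →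
    M a₀ a₁ ≡ M a₀′ a₁′
theorem6p16 p k q p-prime 5≤p q≡pᵏ F s t s′ t′ a₀ a₁ b₀ b₁ a₀′ a₁′ b₀′ b₁′
  _ N′[0]N′[1]≢0 (ψ , φ , equivalent) G≈AB _ irreducibleA irreducibleB G′≈A′B′ _ irreducibleA′ irreducibleB′ =
  M-from-invariants (Mden≢0 2≢0 factors no-rootA no-rootB) (Mden≢0 2≢0 factors′ no-rootA′ no-rootB′)
    (invariant-preserved ψ φ N′[0]N′[1]≢0 equivalent G≈AB no-rootA no-rootB
       factors (slope≢0 2≢0 factors no-rootA no-rootB) G′≈A′B′ no-rootA′)
  where
  open Arithmetic F
  open Polynomials F
  open Invariants F
  open Factorisations F
  open Equivalence F
  2≢0 : 2# ≢ 0#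
  2≢0 = characteristic≢2 p k p-prime 5≤p q≡pᵏ
  factors : Factorisation s t a₀ a₁ b₀ b₁
  factors = factorisation G≈AB
  factors′ : Factorisation s′ t′ a₀′ a₁′ b₀′ b₁′
  factors′ = factorisation G′≈A′B′
  no-rootA : ∀ x → value (quad a₀ a₁) x ≢ 0#
  no-rootA = irreducible⇒no-root irreducibleA
  no-rootB : ∀ x → value (quad b₀ b₁) x ≢ 0#
  no-rootB = irreducible⇒no-root irreducibleB
  no-rootA′ : ∀ x → value (quad a₀′ a₁′) x ≢ 0#
  no-rootA′ = irreducible⇒no-root irreducibleA′
  no-rootB′ : ∀ x → value (quad b₀′ b₁′) x ≢ 0#
  no-rootB′ = irreducible⇒no-root irreducibleB′
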